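{- Suppose $0<\frac1n\ll\mu'\ll\alpha\ll\gamma,\epsilon\ll\delta\ll1$. Let $\mathcal{G}=\{G_1,\ldots,G_n\}$ be a collection of bipartite graphs on a common vertex partition $V=V_1\cup V_2$ with $|V_1|=|V_2|=n$. If $\mathcal{G}$ is $(\gamma,\alpha,\epsilon,\delta)$-stable, then $\mathcal{G}$ is $\mu'$-nice.
   Context: For a bipartite graph collection $\mathcal{G}$ on $V_1\cup V_2$ ($|V_i|=n$), $\mathcal{G}$ is $\mu$-nice if for every $A\subseteq V_1$ and $B\subseteq V_2$ with $|A|=|B|=\lfloor\frac n2\rfloor$, $\sum_{i\in[n]}e_{G_i}(A,B)\ge\mu n^3$. A single balanced bipartite graph $G$ is $\epsilon$-nice if for any $A\subseteq V_1$, $B\subseteq V_2$ of size at least $(\frac12-\epsilon)n$, $e_G(A,B)\ge\epsilon n^2$; $G$ is $\epsilon$-extremal if it is not $\epsilon^5$-nice. For each $\epsilon$-extremal $G_\ell$ a characteristic partition $(A_1^\ell,B_1^\ell,C_1^\ell,A_2^\ell,B_2^\ell,C_2^\ell)$ is fixed, i.e. a partition of $V$ with $A_i^\ell,B_i^\ell,C_i^\ell\subseteq V_i$, $|A_i^\ell|=|B_i^\ell|=(\frac12-\epsilon)n$, $|C_i^\ell|=2\epsilon n$, $d_{G_\ell}(v,X_i^\ell)\ge(\frac12-2\epsilon)n$ for $v\in X_{3-i}^\ell$, $X\in\{A,B\}$, $i\in[2]$, and $e_{G_\ell}(A_1^\ell,B_2^\ell)\le\epsilon n^2$ or $e_{G_\ell}(A_2^\ell,B_1^\ell)\le\epsilon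 n^2$. $\epsilon$-extremal $G_i,G_j$ are $\delta$-crossing if $|A_1^i\triangle A_1^j|\ge\delta n$ and $|A_1^i\triangle B_1^j|\ge\delta n$; the cross graph $C^{\epsilon,\delta}_{\mathcal{G}}$ on $[n]$ has $ij$ an edge iff $G_i,G_j$ are both $\epsilon$-extremal and $\delta$-crossing. $\mathcal{G}$ is $(\gamma,\alpha)$-strongly stable if $G_i$ is $\alpha$-nice for at least $\gamma n$ colors, $(\epsilon,\delta)$-weakly stable if $e(C^{\epsilon,\delta}_{\mathcal{G}})\ge\delta n^2$, and $(\gamma,\alpha,\epsilon,\delta)$-stable if either holds. The notation $\alpha\ll\beta$ means the statement holds whenever $\alpha\le f(\beta)$ for suitable $f$. -}

module Defs where

open import Data.Nat as ℕ using (ℕ; zero; suc)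
open import Data.Nat.DivMod as ℕD using ()
open import Data.Integer as ℤ using (ℤ; +_)
open import Data.Rational as ℚ using (ℚ; ½; 0ℚ)
open import Data.Bool using (Bool; true; false; _∧_; if_then_else_)
open import Data.Fin using (Fin; zero; suc; _<_)
open import Data.Fin.Subset using (Subset; ∣_∣; _∩_; _∪_; _─_; ⊤; ⊥)
open import Data.Vec using (lookup)
open import Data.Product using (Σ; _×_; ∃-syntax)
open import Data.Sum using (_⊎_)
open import Relation.Nullary using (¬_)
open import Relation.Binary.PropositionalEquality using (_≡_)

∑ : ∀ {n} → (Fin n → ℕ) → ℕ
∑ {zero}  f = 0
∑ {suc n} f = f zero ℕ.+ ∑ (λ i → f (suc i))

𝟙 : Bool → ℕ
𝟙 true  = 1
𝟙 false = 0

⟦_⟧ : ℕ → ℚ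
⟦ k ⟧ = + k ℚ./ 1

-- A balanced bipartite graph on V₁ ∪ V₂, V₁ = V₂ = Fin n (two disjoint copies):
-- G a b = true iff a ∈ V₁ is adjacent to b ∈ V₂.
BipGraph : ℕ → Set
BipGraph n = Fin n → Fin n → Bool

Collection : ℕ → Set
Collection n = Fin n → BipGraph n

e : ∀ {n} → BipGraph n → Subset n → Subset n → ℕ
e G A B = ∑ λ a → ∑ λ b → 𝟙 (lookup A a ∧ lookup B b ∧ G a b)

deg₁ : ∀ {n} → BipGraph n → Fin n → Subset n → ℕ
deg₁ G v X = ∑ λ b → 𝟙 (lookup X b ∧ G v b)

deg₂ : ∀ {n} → BipGraph n → Fin n → Subset n → ℕ
deg₂ G v X = ∑ λ a → 𝟙 (lookup X a ∧ G a v)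

MuNice : (n : ℕ) → ℚ → Collection n → Set
MuNice n μ 𝒢 = (A B : Subset n) → ∣ A ∣ ≡ n ℕD./ 2 → ∣ B ∣ ≡ n ℕD./ 2 →
  μ ℚ.* ⟦ n ℕ.^ 3 ⟧ ℚ.≤ ⟦ ∑ (λ i → e (𝒢 i) A B) ⟧

Nice : (n : ℕ) → ℚ → BipGraph n → Set
Nice n ε G = (A B : Subset n) →
  (½ ℚ.- ε) ℚ.* ⟦ n ⟧ ℚ.≤ ⟦ ∣ A ∣ ⟧ → (½ ℚ.- ε) ℚ.* ⟦ n ⟧ ℚ.≤ ⟦ ∣ B ∣ ⟧ →
  ε ℚ.* ⟦ n ℕ.^ 2 ⟧ ℚ.≤ ⟦ e G A B ⟧

Extremal : (n : ℕ) → ℚ → BipGraph n → Set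
Extremal n ε G = ¬ Nice n (ε ℚ.* ε ℚ.* ε ℚ.* ε ℚ.* ε) G

record Partition (n : ℕ) : Set where
  field
    A₁ B₁ C₁ A₂ B₂ C₂ : Subset n
open Partition public

IsPartition3 : ∀ {n} → Subset n → Subset n → Subset n → Set
IsPartition3 X Y Z = (X ∪ Y ∪ Z ≡ ⊤) × (X ∩ Y ≡ ⊥) × (X ∩ Z ≡ ⊥) × (Y ∩ Z ≡ ⊥)

-- P is a characteristic partition of G (with parameter ε).
-- Sizes (1/2 - ε)n are rounded down: |A_i| = |B_i| = ⌊(1/2 - ε)n⌋,
-- and C_i is the rest of V_i (so |C_i| = n - 2⌊(1/2-ε)n⌋ ≈ 2εn).
Characteristic : (n : ℕ) → ℚ → BipGraph n → Partition n → Set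
Characteristic n ε G P =
  IsPartition3 (A₁ P) (B₁ P) (C₁ P) × IsPartition3 (A₂ P) (B₂ P) (C₂ P) ×
  (+ ∣ A₁ P ∣ ≡ s) × (+ ∣ B₁ P ∣ ≡ s) × (+ ∣ A₂ P ∣ ≡ s) × (+ ∣ B₂ P ∣ ≡ s) ×
  (∀ v → lookup (A₂ P) v ≡ true → d ℚ.≤ ⟦ deg₂ G v (A₁ P) ⟧) ×
  (∀ v → lookup (A₁ P) v ≡ true → d ℚ.≤ ⟦ deg₁ G v (A₂ P) ⟧) ×
  (∀ v → lookup (B₂ P) v ≡ true → d ℚ.≤ ⟦ deg₂ G v (B₁ P) ⟧) ×
  (∀ v → lookup (B₁ P) v ≡ true → d ℚ.≤ ⟦ deg₁ G v (B₂ P) ⟧) ×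
  ((⟦ e G (A₁ P) (B₂ P) ⟧ ℚ.≤ ε ℚ.* ⟦ n ℕ.^ 2 ⟧) ⊎
   (⟦ e G (A₂ P) (B₁ P) ⟧ ℚ.≤ ε ℚ.* ⟦ n ℕ.^ 2 ⟧))
  where
    s : ℤ
    s = ℚ.floor ((½ ℚ.- ε) ℚ.* ⟦ n ⟧)
    d : ℚ
    d = (½ ℚ.- (⟦ 2 ⟧ ℚ.* ε)) ℚ.* ⟦ n ⟧

_△_ : ∀ {n} → Subset n → Subset n → Subset n
X △ Y = (X ─ Y) ∪ (Y ─ X)

Crossing : (n : ℕ) → ℚ → Partition n → Partition n → Set
Crossing n δ Pi Pj =
  (δ ℚ.* ⟦ n ⟧ ℚ.≤ ⟦ ∣ A₁ Pi △ A₁ Pj ∣ ⟧) × (δ ℚ.* ⟦ n ⟧ ℚ.≤ ⟦ ∣ A₁ Pi △ B₁ Pj ∣ ⟧)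

StronglyStable : (n : ℕ) → ℚ → ℚ → Collection n → Set
StronglyStable n γ α 𝒢 =
  Σ (Subset n) λ I → (∀ i → lookup I i ≡ true → Nice n α (𝒢 i)) ×
                     (γ ℚ.* ⟦ n ⟧ ℚ.≤ ⟦ ∣ I ∣ ⟧)

-- 𝒢 is (ε,δ)-weakly stable: for a choice P of characteristic partitions of the
-- ε-extremal colours, e(C^{ε,δ}_𝒢) ≥ δ n².  "The cross graph has at least δn²
-- edges" is expressed as: there is a set E of edges of C^{ε,δ}_𝒢 (unordered pairs
-- {i,j}, stored as i < j, with j ∈ E i) with |E| ≥ δ n².
CrossEdge : (n : ℕ) → ℚ → ℚ → Collection n → (Fin n → Partition n) → Fin n → Fin n → Set
CrossEdge n ε δ 𝒢 P i j =
  (i < j) × Extremal n ε (𝒢 i) × Extremal n ε (𝒢 j) × Crossing n δ (P i) (P j)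

WeaklyStable : (n : ℕ) → ℚ → ℚ → Collection n → Set
WeaklyStable n ε δ 𝒢 =
  Σ (Fin n → Partition n) λ P →
    (∀ ℓ → Extremal n ε (𝒢 ℓ) → Characteristic n ε (𝒢 ℓ) (P ℓ)) ×
    Σ (Fin n → Subset n) λ E →
      (∀ i j → lookup (E i) j ≡ true → CrossEdge n ε δ 𝒢 P i j) ×
      (δ ℚ.* ⟦ n ℕ.^ 2 ⟧ ℚ.≤ ⟦ ∑ (λ i → ∣ E i ∣) ⟧)

Stable : (n : ℕ) → ℚ → ℚ → ℚ → ℚ → Collection n → Set
Stable n γ α ε δ 𝒢 = StronglyStable n γ α 𝒢 ⊎ WeaklyStable n ε δ 𝒢

module Submission where

-- In the strongly stable case at least γn colours are α-nice, and each of them has at least αn²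
-- edges between two halves A and B. In the weakly stable case fix K ≥ 128/δ with ε ≤ 1/K and call
-- a colour light if it has fewer than n²/K edges between A and B. Let G be light and extremal with
-- characteristic partition (A₁,B₁,C₁,A₂,B₂,C₂). Since |C₁| = O(n/K), A meets A₁ or B₁, say A₁, in
-- at least n/8 vertices; each of them sees all but n/K vertices of A₂, so sparseness forces
-- |B ∩ A₂| = O(n/K). Then B lies mostly in B₂, vertices of B₁ see all but n/K of B₂, and sparseness
-- forces |A ∩ B₁| = O(n/K); hence |A △ A₁| = O(n/K). Two light extremal colours therefore have
-- A₁-sets that nearly coincide or nearly complement each other, so they are not δ-crossing. Every
-- edge of the cross graph thus meets a heavy colour, at least δn/2 colours are heavy, and they alone
-- contribute δn³/(2K) edges.

module Counting where

  open import Defs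
  open import Data.Bool using (Bool; true; false; _∧_; _∨_; _xor_)
  open import Data.Empty using (⊥; ⊥-elim)
  open import Data.Fin using (Fin; zero; suc)
  open import Data.Fin.Subset using (Subset; ∣_∣; _∩_; _∪_; ⊤) renaming (⊥ to ∅)
  open import Data.Fin.Subset.Properties using (∣p∣≤n)
  open import Data.Nat
  open import Data.Nat.Properties
  open import Data.Nat.Tactic.RingSolver using (solve-∀)
  open import Data.Product using (_,_)
  open import Data.Vec using ([]; _∷_; lookup)
  open import Data.Vec.Properties using (lookup-zipWith; lookup-replicate)
  open import Function using (_∘_)
  open import Relation.Binary.PropositionalEquality

  ∑-cong : ∀ {n} {f g : Fin n → ℕ} → (∀ i → f i ≡ g i) → ∑ f ≡ ∑ g
  ∑-cong {zero}  f≡g = refl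
  ∑-cong {suc n} f≡g = cong₂ _+_ (f≡g zero) (∑-cong (f≡g ∘ suc))

  ∑-mono : ∀ {n} {f g : Fin n → ℕ} → (∀ i → f i ≤ g i) → ∑ f ≤ ∑ g
  ∑-mono {zero}  f≤g = z≤n
  ∑-mono {suc n} f≤g = +-mono-≤ (f≤g zero) (∑-mono (f≤g ∘ suc))

  ∑-+ : ∀ {n} (f g : Fin n → ℕ) → ∑ (λ i → f i + g i) ≡ ∑ f + ∑ g
  ∑-+ {zero}  f g = refl
  ∑-+ {suc n} f g = trans (cong (f zero + g zero +_) (∑-+ (f ∘ suc) (g ∘ suc)))
                          (+-+-interchange (f zero) (g zero) _ _)
    where
    +-+-interchange : ∀ a b c d → a + b + (c + d) ≡ a + c + (b + d)
    +-+-interchange = solve-∀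

  ∑-+₃ : ∀ {n} (f g h : Fin n → ℕ) → ∑ (λ i → f i + g i + h i) ≡ ∑ f + ∑ g + ∑ h
  ∑-+₃ f g h = trans (∑-+ (λ i → f i + g i) h) (cong (_+ ∑ h) (∑-+ f g))

  ∑-*ˡ : ∀ {n} c (f : Fin n → ℕ) → ∑ (λ i → c * f i) ≡ c * ∑ f
  ∑-*ˡ {zero}  c f = sym (*-zeroʳ c)
  ∑-*ˡ {suc n} c f = trans (cong (c * f zero +_) (∑-*ˡ c (f ∘ suc)))
                           (sym (*-distribˡ-+ c (f zero) _))

  ∑-*ʳ : ∀ {n} (f : Fin n → ℕ) c → ∑ (λ i → f i * c) ≡ ∑ f * c
  ∑-*ʳ f c = trans (∑-cong (λ i → *-comm (f i) c)) (trans (∑-*ˡ c f) (*-comm c (∑ f)))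

  ∑-const : ∀ {n} c → ∑ {n} (λ _ → c) ≡ n * c
  ∑-const {zero}  c = refl
  ∑-const {suc n} c = cong (c +_) (∑-const {n} c)

  ∣∣≡∑𝟙 : ∀ {n} (X : Subset n) → ∣ X ∣ ≡ ∑ (𝟙 ∘ lookup X)
  ∣∣≡∑𝟙 []          = refl
  ∣∣≡∑𝟙 (true ∷ X)  = cong suc (∣∣≡∑𝟙 X)
  ∣∣≡∑𝟙 (false ∷ X) = ∣∣≡∑𝟙 X

  ∑𝟙*≤∑ : ∀ {n} (p : Fin n → Bool) {m} {f : Fin n → ℕ} →
          (∀ i → p i ≡ true → m ≤ f i) → ∑ (𝟙 ∘ p) * m ≤ ∑ f
  ∑𝟙*≤∑ p {m} {f} p⇒m≤f = subst (_≤ ∑ f) (∑-*ʳ (𝟙 ∘ p) m) (∑-mono pointwise)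
    where
    pointwise : ∀ i → 𝟙 (p i) * m ≤ f i
    pointwise i with p i in pi≡b
    ... | true  = subst (_≤ f i) (sym (+-identityʳ m)) (p⇒m≤f i pi≡b)
    ... | false = z≤n

  ∣∣*≤∑ : ∀ {n} (I : Subset n) {m} {f : Fin n → ℕ} →
          (∀ i → lookup I i ≡ true → m ≤ f i) → ∣ I ∣ * m ≤ ∑ f
  ∣∣*≤∑ I {m} i∈I⇒m≤f = subst (λ k → k * m ≤ _) (sym (∣∣≡∑𝟙 I)) (∑𝟙*≤∑ (lookup I) i∈I⇒m≤f)

  lookup-∩ : ∀ {n} (X Y : Subset n) i → lookup (X ∩ Y) i ≡ (lookup X i ∧ lookup Y i)
  lookup-∩ X Y i = lookup-zipWith _∧_ i X Y

  lookup-∪ : ∀ {n} (X Y : Subset n) i → lookup (X ∪ Y) i ≡ (lookup X i ∨ lookup Y i)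
  lookup-∪ X Y i = lookup-zipWith _∨_ i X Y

  lookup-△ : ∀ {n} (X Y : Subset n) i → lookup (X △ Y) i ≡ (lookup X i xor lookup Y i)
  lookup-△ (true  ∷ _) (true  ∷ _) zero    = refl
  lookup-△ (true  ∷ _) (false ∷ _) zero    = refl
  lookup-△ (false ∷ _) (true  ∷ _) zero    = refl
  lookup-△ (false ∷ _) (false ∷ _) zero    = refl
  lookup-△ (_ ∷ X)     (_ ∷ Y)     (suc i) = lookup-△ X Y i

  ∣∩∣≡∑ : ∀ {n} (X Y : Subset n) → ∣ X ∩ Y ∣ ≡ ∑ (λ i → 𝟙 (lookup X i ∧ lookup Y i))
  ∣∩∣≡∑ X Y = trans (∣∣≡∑𝟙 (X ∩ Y)) (∑-cong (cong 𝟙 ∘ lookup-∩ X Y))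

  ∣△∣≡∑ : ∀ {n} (X Y : Subset n) → ∣ X △ Y ∣ ≡ ∑ (λ i → 𝟙 (lookup X i xor lookup Y i))
  ∣△∣≡∑ X Y = trans (∣∣≡∑𝟙 (X △ Y)) (∑-cong (cong 𝟙 ∘ lookup-△ X Y))

  data ExactlyOne : Bool → Bool → Bool → Set where
    first  : ExactlyOne true  false false
    second : ExactlyOne false true  false
    third  : ExactlyOne false false true

  record Splits {n} (X Y Z : Subset n) : Set where
    constructor splits
    field
      exactlyOne-at : ∀ i → ExactlyOne (lookup X i) (lookup Y i) (lookup Z i)
  open Splits public

  Splits-swap : ∀ {n} {X Y Z : Subset n} → Splits X Y Z → Splits Y X Z
  Splits-swap split = splits (swap ∘ exactlyOne-at split)
    where
    swap : ∀ {x y z} → ExactlyOne x y z → ExactlyOne y x z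
    swap first  = second
    swap second = first
    swap third  = third

  IsPartition3⇒Splits : ∀ {n} {X Y Z : Subset n} → IsPartition3 X Y Z → Splits X Y Z
  IsPartition3⇒Splits {X = X} {Y} {Z} (X∪Y∪Z≡⊤ , X∩Y≡∅ , X∩Z≡∅ , Y∩Z≡∅) = splits λ i →
    exactlyOne _ _ _ (covered i) (empty X Y X∩Y≡∅ i) (empty X Z X∩Z≡∅ i) (empty Y Z Y∩Z≡∅ i)
    where
    open ≡-Reasoning
    covered : ∀ i → lookup X i ∨ (lookup Y i ∨ lookup Z i) ≡ true
    covered i = begin
      lookup X i ∨ (lookup Y i ∨ lookup Z i) ≡⟨ cong (lookup X i ∨_) (lookup-∪ Y Z i) ⟨
      lookup X i ∨ lookup (Y ∪ Z) i         ≡⟨ lookup-∪ X (Y ∪ Z) i ⟨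
      lookup (X ∪ Y ∪ Z) i                  ≡⟨ cong (λ W → lookup W i) X∪Y∪Z≡⊤ ⟩
      lookup ⊤ i                            ≡⟨ lookup-replicate i true ⟩
      true                                  ∎
    empty : ∀ V W → V ∩ W ≡ ∅ → ∀ i → lookup V i ∧ lookup W i ≡ false
    empty V W V∩W≡∅ i = trans (sym (lookup-∩ V W i))
                              (trans (cong (λ U → lookup U i) V∩W≡∅) (lookup-replicate i false))
    exactlyOne : ∀ x y z → x ∨ (y ∨ z) ≡ true →
                 x ∧ y ≡ false → x ∧ z ≡ false → y ∧ z ≡ false → ExactlyOne x y z
    exactlyOne true  false false _  _  _  _  = first
    exactlyOne false true  false _  _  _  _  = second
    exactlyOne false false true  _  _  _  _  = third
    exactlyOne true  true  _     _  () _  _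
    exactlyOne true  false true  _  _  () _
    exactlyOne false true  true  _  _  _  ()
    exactlyOne false false false () _  _  _

  Splits⇒∣∣+∣∣+∣∣≡n : ∀ {n} {X Y Z : Subset n} → Splits X Y Z → ∣ X ∣ + ∣ Y ∣ + ∣ Z ∣ ≡ n
  Splits⇒∣∣+∣∣+∣∣≡n {n} {X} {Y} {Z} split = begin
    ∣ X ∣ + ∣ Y ∣ + ∣ Z ∣
      ≡⟨ cong₂ _+_ (cong₂ _+_ (∣∣≡∑𝟙 X) (∣∣≡∑𝟙 Y)) (∣∣≡∑𝟙 Z) ⟩
    ∑ (𝟙 ∘ lookup X) + ∑ (𝟙 ∘ lookup Y) + ∑ (𝟙 ∘ lookup Z)
      ≡⟨ ∑-+₃ (𝟙 ∘ lookup X) (𝟙 ∘ lookup Y) (𝟙 ∘ lookup Z) ⟨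
    ∑ (λ i → 𝟙 (lookup X i) + 𝟙 (lookup Y i) + 𝟙 (lookup Z i))
      ≡⟨ ∑-cong (one ∘ exactlyOne-at split) ⟩
    ∑ {n} (λ _ → 1)
      ≡⟨ trans (∑-const {n} 1) (*-identityʳ n) ⟩
    n ∎
    where
    open ≡-Reasoning
    one : ∀ {x y z} → ExactlyOne x y z → 𝟙 x + 𝟙 y + 𝟙 z ≡ 1
    one first  = refl
    one second = refl
    one third  = refl

  Splits⇒∣∣≤∣∩∣+∣∩∣+∣∣ : ∀ {n} {X Y Z : Subset n} → Splits X Y Z →
                          ∀ C → ∣ C ∣ ≤ ∣ C ∩ X ∣ + ∣ C ∩ Y ∣ + ∣ Z ∣
  Splits⇒∣∣≤∣∩∣+∣∩∣+∣∣ {n} {X = X} {Y} {Z} split C =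
    subst₂ _≤_ (sym (∣∣≡∑𝟙 C))
      (trans (∑-+₃ {n} _ _ _) (sym (cong₂ _+_ (cong₂ _+_ (∣∩∣≡∑ C X) (∣∩∣≡∑ C Y)) (∣∣≡∑𝟙 Z))))
      (∑-mono λ i → pointwise (lookup C i) (exactlyOne-at split i))
    where
    pointwise : ∀ c {x y z} → ExactlyOne x y z → 𝟙 c ≤ 𝟙 (c ∧ x) + 𝟙 (c ∧ y) + 𝟙 z
    pointwise false _      = z≤n
    pointwise true  first  = ≤-refl
    pointwise true  second = ≤-refl
    pointwise true  third  = ≤-refl

  ∣△∣+2∣∩∣≡∣∣+∣∣ : ∀ {n} (X Y : Subset n) → ∣ X △ Y ∣ + 2 * ∣ X ∩ Y ∣ ≡ ∣ X ∣ + ∣ Y ∣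
  ∣△∣+2∣∩∣≡∣∣+∣∣ {n} X Y = begin
    ∣ X △ Y ∣ + 2 * ∣ X ∩ Y ∣
      ≡⟨ cong₂ (λ d c → d + 2 * c) (∣△∣≡∑ X Y) (∣∩∣≡∑ X Y) ⟩
    ∑ (λ i → 𝟙 (lookup X i xor lookup Y i)) + 2 * ∑ (λ i → 𝟙 (lookup X i ∧ lookup Y i))
      ≡⟨ cong (∑ (λ i → 𝟙 (lookup X i xor lookup Y i)) +_)
              (∑-*ˡ {n} 2 (λ i → 𝟙 (lookup X i ∧ lookup Y i))) ⟨
    ∑ (λ i → 𝟙 (lookup X i xor lookup Y i)) + ∑ (λ i → 2 * 𝟙 (lookup X i ∧ lookup Y i))
      ≡⟨ ∑-+ {n} _ _ ⟨
    ∑ (λ i → 𝟙 (lookup X i xor lookup Y i) + 2 * 𝟙 (lookup X i ∧ lookup Y i))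
      ≡⟨ ∑-cong (λ i → pointwise (lookup X i) (lookup Y i)) ⟩
    ∑ (λ i → 𝟙 (lookup X i) + 𝟙 (lookup Y i))
      ≡⟨ ∑-+ {n} _ _ ⟩
    ∑ (𝟙 ∘ lookup X) + ∑ (𝟙 ∘ lookup Y)
      ≡⟨ cong₂ _+_ (∣∣≡∑𝟙 X) (∣∣≡∑𝟙 Y) ⟨
    ∣ X ∣ + ∣ Y ∣ ∎
    where
    open ≡-Reasoning
    pointwise : ∀ x y → 𝟙 (x xor y) + 2 * 𝟙 (x ∧ y) ≡ 𝟙 x + 𝟙 y
    pointwise true  true  = refl
    pointwise true  false = refl
    pointwise false true  = refl
    pointwise false false = refl

  ∣△∣≤∣△∣+∣△∣ : ∀ {n} (A X Y : Subset n) → ∣ X △ Y ∣ ≤ ∣ A △ X ∣ + ∣ A △ Y ∣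
  ∣△∣≤∣△∣+∣△∣ {n} A X Y =
    subst₂ _≤_ (sym (∣△∣≡∑ X Y)) (trans (∑-+ {n} _ _) (sym (cong₂ _+_ (∣△∣≡∑ A X) (∣△∣≡∑ A Y))))
      (∑-mono λ i → pointwise (lookup A i) (lookup X i) (lookup Y i))
    where
    pointwise : ∀ a x y → 𝟙 (x xor y) ≤ 𝟙 (a xor x) + 𝟙 (a xor y)
    pointwise true  true  true  = z≤n
    pointwise true  true  false = s≤s z≤n
    pointwise true  false true  = s≤s z≤n
    pointwise true  false false = z≤n
    pointwise false true  true  = z≤n
    pointwise false true  false = s≤s z≤n
    pointwise false false true  = s≤s z≤n
    pointwise false false false = z≤n

  Splits⇒∣△∣≤∣△∣+∣∣+∣∣ : ∀ {n} {X Y Z X′ Y′ Z′ : Subset n} → Splits X Y Z → Splits X′ Y′ Z′ →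
                           ∣ X △ X′ ∣ ≤ ∣ Y △ Y′ ∣ + ∣ Z ∣ + ∣ Z′ ∣
  Splits⇒∣△∣≤∣△∣+∣∣+∣∣ {n} {X = X} {Y} {Z} {X′} {Y′} {Z′} split split′ =
    subst₂ _≤_ (sym (∣△∣≡∑ X X′))
      (trans (∑-+₃ {n} _ _ _) (sym (cong₂ _+_ (cong₂ _+_ (∣△∣≡∑ Y Y′) (∣∣≡∑𝟙 Z)) (∣∣≡∑𝟙 Z′))))
      (∑-mono λ i → pointwise (exactlyOne-at split i) (exactlyOne-at split′ i))
    where
    pointwise : ∀ {x y z x′ y′ z′} → ExactlyOne x y z → ExactlyOne x′ y′ z′ →
                𝟙 (x xor x′) ≤ 𝟙 (y xor y′) + 𝟙 z + 𝟙 z′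
    pointwise first  first  = z≤n
    pointwise first  second = s≤s z≤n
    pointwise first  third  = s≤s z≤n
    pointwise second first  = s≤s z≤n
    pointwise second second = z≤n
    pointwise second third  = z≤n
    pointwise third  first  = s≤s z≤n
    pointwise third  second = z≤n
    pointwise third  third  = z≤n

  e≡∑𝟙*deg₁ : ∀ {n} (G : BipGraph n) A B → e G A B ≡ ∑ (λ v → 𝟙 (lookup A v) * deg₁ G v B)
  e≡∑𝟙*deg₁ {n} G A B = ∑-cong λ v → pull-out (lookup A v) (λ w → lookup B w ∧ G v w)
    where
    pull-out : ∀ a (f : Fin n → Bool) → ∑ (λ w → 𝟙 (a ∧ f w)) ≡ 𝟙 a * ∑ (𝟙 ∘ f)
    pull-out true  f = sym (+-identityʳ _)
    pull-out false f = trans (∑-const {n} 0) (*-zeroʳ n)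

  e-∩≡∑ : ∀ {n} (G : BipGraph n) A X B →
          e G (A ∩ X) B ≡ ∑ (λ v → 𝟙 (lookup A v ∧ lookup X v) * deg₁ G v B)
  e-∩≡∑ G A X B = trans (e≡∑𝟙*deg₁ G (A ∩ X) B) (∑-cong λ v → cong (λ b → 𝟙 b * _) (lookup-∩ A X v))

  Splits⇒e-∩+e-∩≤e : ∀ {n} {X Y Z : Subset n} → Splits X Y Z →
                      ∀ G A B → e G (A ∩ X) B + e G (A ∩ Y) B ≤ e G A B
  Splits⇒e-∩+e-∩≤e {n} {X} {Y} split G A B =
    subst₂ _≤_ (trans (∑-+ {n} _ _) (sym (cong₂ _+_ (e-∩≡∑ G A X B) (e-∩≡∑ G A Y B))))
               (sym (e≡∑𝟙*deg₁ G A B))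
      (∑-mono λ v → pointwise (lookup A v) (exactlyOne-at split v) (deg₁ G v B))
    where
    pointwise : ∀ a {x y z} → ExactlyOne x y z → ∀ d → 𝟙 (a ∧ x) * d + 𝟙 (a ∧ y) * d ≤ 𝟙 a * d
    pointwise false _      d = z≤n
    pointwise true  first  d = ≤-reflexive (+-identityʳ _)
    pointwise true  second d = ≤-refl
    pointwise true  third  d = z≤n

  deg₁+∣∩∣≤deg₁+∣∣ : ∀ {n} (G : BipGraph n) v B Y → deg₁ G v Y + ∣ B ∩ Y ∣ ≤ deg₁ G v B + ∣ Y ∣
  deg₁+∣∩∣≤deg₁+∣∣ {n} G v B Y =
    subst₂ _≤_ (trans (∑-+ {n} _ _) (cong (deg₁ G v Y +_) (sym (∣∩∣≡∑ B Y))))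
               (trans (∑-+ {n} _ _) (cong (deg₁ G v B +_) (sym (∣∣≡∑𝟙 Y))))
      (∑-mono λ w → pointwise (lookup Y w) (G v w) (lookup B w))
    where
    pointwise : ∀ y g b → 𝟙 (y ∧ g) + 𝟙 (b ∧ y) ≤ 𝟙 (b ∧ g) + 𝟙 y
    pointwise true  true  true  = ≤-refl
    pointwise true  true  false = ≤-refl
    pointwise true  false true  = ≤-refl
    pointwise true  false false = z≤n
    pointwise false _     true  = z≤n
    pointwise false _     false = z≤n

  ∣∩∣*K∣∩∣≤Ke+t∣∩∣ : ∀ {n} (G : BipGraph n) K t {s} {X Y : Subset n} → ∣ Y ∣ ≡ s →
    (∀ v → lookup X v ≡ true → K * s ≤ K * deg₁ G v Y + t) →
    ∀ A B → ∣ A ∩ X ∣ * (K * ∣ B ∩ Y ∣) ≤ K * e G (A ∩ X) B + t * ∣ A ∩ X ∣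
  ∣∩∣*K∣∩∣≤Ke+t∣∩∣ {n} G K t {s} {X} {Y} ∣Y∣≡s dense A B = begin
    ∣ A ∩ X ∣ * (K * ∣ B ∩ Y ∣)
      ≡⟨ cong (_* _) (∣∩∣≡∑ A X) ⟩
    ∑ (λ v → 𝟙 (lookup A v ∧ lookup X v)) * (K * ∣ B ∩ Y ∣)
      ≡⟨ ∑-*ʳ {n} _ (K * ∣ B ∩ Y ∣) ⟨
    ∑ (λ v → 𝟙 (lookup A v ∧ lookup X v) * (K * ∣ B ∩ Y ∣))
      ≤⟨ ∑-mono (λ v → on-X (lookup A v) (lookup X v) (row-bound v)) ⟩
    ∑ (λ v → 𝟙 (lookup A v ∧ lookup X v) * (K * deg₁ G v B + t))
      ≡⟨ ∑-cong (λ v → distrib (𝟙 (lookup A v ∧ lookup X v)) K (deg₁ G v B) t) ⟩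
    ∑ (λ v → K * (𝟙 (lookup A v ∧ lookup X v) * deg₁ G v B) + t * 𝟙 (lookup A v ∧ lookup X v))
      ≡⟨ trans (∑-+ {n} _ _) (cong₂ _+_ (∑-*ˡ {n} K _) (∑-*ˡ {n} t _)) ⟩
    K * ∑ (λ v → 𝟙 (lookup A v ∧ lookup X v) * deg₁ G v B) + t * ∑ (λ v → 𝟙 (lookup A v ∧ lookup X v))
      ≡⟨ cong₂ (λ m k → K * m + t * k) (e-∩≡∑ G A X B) (∣∩∣≡∑ A X) ⟨
    K * e G (A ∩ X) B + t * ∣ A ∩ X ∣ ∎
    where
    open ≤-Reasoning
    distrib : ∀ a K d t → a * (K * d + t) ≡ K * (a * d) + t * a
    distrib = solve-∀
    row-bound : ∀ v → lookup X v ≡ true → K * ∣ B ∩ Y ∣ ≤ K * deg₁ G v B + t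
    row-bound v v∈X = +-cancelʳ-≤ (K * deg₁ G v Y) _ _ (begin
      K * ∣ B ∩ Y ∣ + K * deg₁ G v Y   ≡⟨ trans (+-comm (K * ∣ B ∩ Y ∣) _) (sym (*-distribˡ-+ K _ _)) ⟩
      K * (deg₁ G v Y + ∣ B ∩ Y ∣)     ≤⟨ *-monoʳ-≤ K (deg₁+∣∩∣≤deg₁+∣∣ G v B Y) ⟩
      K * (deg₁ G v B + ∣ Y ∣)         ≡⟨ trans (*-distribˡ-+ K _ _)
                                               (cong (λ m → K * deg₁ G v B + K * m) ∣Y∣≡s) ⟩
      K * deg₁ G v B + K * s           ≤⟨ +-monoʳ-≤ (K * deg₁ G v B) (dense v v∈X) ⟩
      K * deg₁ G v B + (K * deg₁ G v Y + t) ≡⟨ rearrange (K * deg₁ G v B) (K * deg₁ G v Y) t ⟩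
      K * deg₁ G v B + t + K * deg₁ G v Y ∎)
      where
      rearrange : ∀ a b c → a + (b + c) ≡ a + c + b
      rearrange = solve-∀
    on-X : ∀ a x {m k} → (x ≡ true → m ≤ k) → 𝟙 (a ∧ x) * m ≤ 𝟙 (a ∧ x) * k
    on-X true  true  m≤k = *-monoʳ-≤ 1 (m≤k refl)
    on-X true  false m≤k = z≤n
    on-X false x     m≤k = z≤n

  ∑∣∣≤2n∑𝟙 : ∀ {n} (E : Fin n → Subset n) (p : Fin n → Bool) →
             (∀ i j → lookup (E i) j ≡ true → p i ≡ false → p j ≡ false → ⊥) →
             ∑ (λ i → ∣ E i ∣) ≤ 2 * n * ∑ (𝟙 ∘ p)
  ∑∣∣≤2n∑𝟙 {n} E p covered = begin
    ∑ (λ i → ∣ E i ∣)                  ≤⟨ ∑-mono row ⟩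
    ∑ (λ i → n * 𝟙 (p i) + g)          ≡⟨ ∑-+ {n} _ _ ⟩
    ∑ (λ i → n * 𝟙 (p i)) + ∑ {n} (λ _ → g) ≡⟨ cong₂ _+_ (∑-*ˡ {n} n (𝟙 ∘ p)) (∑-const {n} g) ⟩
    n * g + n * g                      ≡⟨ double n g ⟩
    2 * n * g                          ∎
    where
    open ≤-Reasoning
    g : ℕ
    g = ∑ (𝟙 ∘ p)
    double : ∀ n g → n * g + n * g ≡ 2 * n * g
    double = solve-∀
    into-p : ∀ i → p i ≡ false → ∀ j → 𝟙 (lookup (E i) j) ≤ 𝟙 (p j)
    into-p i pi≡false j with lookup (E i) j in ij∈E | p j in pj≡b
    ... | false | _     = z≤n
    ... | true  | true  = ≤-refl
    ... | true  | false = ⊥-elim (covered i j ij∈E pi≡false pj≡b)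
    row : ∀ i → ∣ E i ∣ ≤ n * 𝟙 (p i) + g
    row i with p i in pi≡b
    ... | true  = ≤-trans (∣p∣≤n (E i)) (≤-trans (≤-reflexive (sym (*-identityʳ n))) (m≤m+n (n * 1) g))
    ... | false = subst (∣ E i ∣ ≤_) (cong (_+ g) (sym (*-zeroʳ n)))
                        (subst (_≤ g) (sym (∣∣≡∑𝟙 (E i))) (∑-mono (into-p i pi≡b)))

module Rationals where

  open import Defs
  open import Data.Nat
  open import Data.Nat.Properties
  open import Data.Nat.Coprimality using (1-coprimeTo) renaming (sym to coprime-sym)
  open import Data.Integer as ℤ using (+_; +[1+_]; -[1+_])
  import Data.Integer.Properties as ℤ
  import Data.Integer.DivMod as ℤ
  open import Data.Rational as ℚ using (ℚ; mkℚ; ↧ₙ_; ½; 0ℚ; 1ℚ; NonNegative)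
  import Data.Rational.Properties as ℚ
  open import Data.Rational.Solver using (module +-*-Solver)
  open import Data.Product using (_×_; _,_)
  open import Function using (_∘_)
  open import Relation.Binary.PropositionalEquality

  ⟦⟧≡mkℚ : ∀ k → ⟦ k ⟧ ≡ mkℚ (+ k) 0 (coprime-sym (1-coprimeTo k))
  ⟦⟧≡mkℚ k = ℚ.normalize-coprime (coprime-sym (1-coprimeTo k))

  ⟦+⟧ : ∀ a b → ⟦ a ⟧ ℚ.+ ⟦ b ⟧ ≡ ⟦ a + b ⟧
  ⟦+⟧ a b rewrite ⟦⟧≡mkℚ a | ⟦⟧≡mkℚ b =
    cong₂ (λ x y → (x ℤ.+ y) ℚ./ 1) (trans (ℤ.+◃n≡+n (a * 1)) (cong +_ (*-identityʳ a)))
                                    (trans (ℤ.+◃n≡+n (b * 1)) (cong +_ (*-identityʳ b)))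

  ⟦*⟧ : ∀ a b → ⟦ a ⟧ ℚ.* ⟦ b ⟧ ≡ ⟦ a * b ⟧
  ⟦*⟧ a b rewrite ⟦⟧≡mkℚ a | ⟦⟧≡mkℚ b = cong (ℚ._/ 1) (sym (ℤ.pos-* a b))

  ⟦⟧-mono-≤ : ∀ {a b} → a ≤ b → ⟦ a ⟧ ℚ.≤ ⟦ b ⟧
  ⟦⟧-mono-≤ {a} {b} a≤b rewrite ⟦⟧≡mkℚ a | ⟦⟧≡mkℚ b =
    ℚ.*≤* (subst₂ ℤ._≤_ (sym (ℤ.*-identityʳ (+ a))) (sym (ℤ.*-identityʳ (+ b))) (ℤ.+≤+ a≤b))

  ⟦⟧-cancel-≤ : ∀ {a b} → ⟦ a ⟧ ℚ.≤ ⟦ b ⟧ → a ≤ b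
  ⟦⟧-cancel-≤ {a} {b} ⟦a⟧≤⟦b⟧ rewrite ⟦⟧≡mkℚ a | ⟦⟧≡mkℚ b with ⟦a⟧≤⟦b⟧
  ... | ℚ.*≤* a*1≤b*1 = ℤ.drop‿+≤+ (subst₂ ℤ._≤_ (ℤ.*-identityʳ (+ a)) (ℤ.*-identityʳ (+ b)) a*1≤b*1)

  ⟦⟧-nonNeg : ∀ a → NonNegative ⟦ a ⟧
  ⟦⟧-nonNeg a = ℚ.normalize-nonNeg a 1

  *⟦⟧-mono-≤ : ∀ a {p q} → p ℚ.≤ q → p ℚ.* ⟦ a ⟧ ℚ.≤ q ℚ.* ⟦ a ⟧
  *⟦⟧-mono-≤ a = ℚ.*-monoʳ-≤-nonNeg ⟦ a ⟧ {{⟦⟧-nonNeg a}}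

  ⟦⟧*-mono-≤ : ∀ a {p q} → p ℚ.≤ q → ⟦ a ⟧ ℚ.* p ℚ.≤ ⟦ a ⟧ ℚ.* q
  ⟦⟧*-mono-≤ a = ℚ.*-monoˡ-≤-nonNeg ⟦ a ⟧ {{⟦⟧-nonNeg a}}

  1/ℕ : (m : ℕ) .{{_ : NonZero m}} → ℚ
  1/ℕ (suc k) = mkℚ (+ 1) k (1-coprimeTo (suc k))

  1/ℕ-pos : ∀ m .{{_ : NonZero m}} → 0ℚ ℚ.< 1/ℕ m
  1/ℕ-pos (suc k) = ℚ.*<* (ℤ.+<+ (s≤s z≤n))

  1/ℕ*⟦⟧≡1 : ∀ m .{{_ : NonZero m}} → 1/ℕ m ℚ.* ⟦ m ⟧ ≡ 1ℚ
  1/ℕ*⟦⟧≡1 (suc k) rewrite ⟦⟧≡mkℚ (suc k) =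
    ℚ.*-inverseˡ (mkℚ (+ suc k) 0 (coprime-sym (1-coprimeTo (suc k))))

  ⟦⟧*[1/ℕ*]≡ : ∀ m .{{_ : NonZero m}} p → ⟦ m ⟧ ℚ.* (1/ℕ m ℚ.* p) ≡ p
  ⟦⟧*[1/ℕ*]≡ m p = begin
    ⟦ m ⟧ ℚ.* (1/ℕ m ℚ.* p) ≡⟨ ℚ.*-assoc ⟦ m ⟧ (1/ℕ m) p ⟨
    ⟦ m ⟧ ℚ.* 1/ℕ m ℚ.* p   ≡⟨ cong (ℚ._* p) (trans (ℚ.*-comm ⟦ m ⟧ (1/ℕ m)) (1/ℕ*⟦⟧≡1 m)) ⟩
    1ℚ ℚ.* p                ≡⟨ ℚ.*-identityˡ p ⟩
    p                       ∎
    where open ≡-Reasoning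

  1/↧ₙ≤ : ∀ q → 0ℚ ℚ.< q → 1/ℕ (↧ₙ q) ℚ.≤ q
  1/↧ₙ≤ (mkℚ +[1+ p ] d _) _ = ℚ.*≤* (ℤ.+≤+ (*-monoˡ-≤ (suc d) {1} {suc p} (s≤s z≤n)))
  1/↧ₙ≤ (mkℚ (+ 0) d _) (ℚ.*<* (ℤ.+<+ ()))
  1/↧ₙ≤ (mkℚ -[1+ p ] d _) (ℚ.*<* ())

  q*⟦a⟧≤⟦b⟧⇒a≤↧ₙq*b : ∀ q → 0ℚ ℚ.< q → ∀ a b → q ℚ.* ⟦ a ⟧ ℚ.≤ ⟦ b ⟧ → a ≤ ↧ₙ q * b
  q*⟦a⟧≤⟦b⟧⇒a≤↧ₙq*b q q>0 a b q*a≤b = ⟦⟧-cancel-≤ (begin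
    ⟦ a ⟧                              ≡⟨ ⟦⟧*[1/ℕ*]≡ (↧ₙ q) ⟦ a ⟧ ⟨
    ⟦ ↧ₙ q ⟧ ℚ.* (1/ℕ (↧ₙ q) ℚ.* ⟦ a ⟧) ≤⟨ ⟦⟧*-mono-≤ (↧ₙ q) (*⟦⟧-mono-≤ a (1/↧ₙ≤ q q>0)) ⟩
    ⟦ ↧ₙ q ⟧ ℚ.* (q ℚ.* ⟦ a ⟧)          ≤⟨ ⟦⟧*-mono-≤ (↧ₙ q) q*a≤b ⟩
    ⟦ ↧ₙ q ⟧ ℚ.* ⟦ b ⟧                 ≡⟨ ⟦*⟧ (↧ₙ q) b ⟩
    ⟦ ↧ₙ q * b ⟧                       ∎)
    where open ℚ.≤-Reasoning

  ≤1/ℕ⇒*⟦⟧≤ : ∀ {μ} m .{{_ : NonZero m}} {x y} → μ ℚ.≤ 1/ℕ m → y ≤ m * x → μ ℚ.* ⟦ y ⟧ ℚ.≤ ⟦ x ⟧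
  ≤1/ℕ⇒*⟦⟧≤ {μ} m {x} {y} μ≤1/m y≤m*x = begin
    μ ℚ.* ⟦ y ⟧               ≤⟨ *⟦⟧-mono-≤ y μ≤1/m ⟩
    1/ℕ m ℚ.* ⟦ y ⟧           ≤⟨ ℚ.*-monoˡ-≤-nonNeg (1/ℕ m) {{1/m≥0}} (⟦⟧-mono-≤ y≤m*x) ⟩
    1/ℕ m ℚ.* ⟦ m * x ⟧       ≡⟨ cong (1/ℕ m ℚ.*_) (⟦*⟧ m x) ⟨
    1/ℕ m ℚ.* (⟦ m ⟧ ℚ.* ⟦ x ⟧) ≡⟨ ℚ.*-assoc (1/ℕ m) ⟦ m ⟧ ⟦ x ⟧ ⟨
    1/ℕ m ℚ.* ⟦ m ⟧ ℚ.* ⟦ x ⟧  ≡⟨ cong (ℚ._* ⟦ x ⟧) (1/ℕ*⟦⟧≡1 m) ⟩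
    1ℚ ℚ.* ⟦ x ⟧              ≡⟨ ℚ.*-identityˡ ⟦ x ⟧ ⟩
    ⟦ x ⟧                     ∎
    where
    open ℚ.≤-Reasoning
    1/m≥0 : NonNegative (1/ℕ m)
    1/m≥0 = ℚ.pos⇒nonNeg (1/ℕ m) {{ℚ.positive (1/ℕ-pos m)}}

  floor≡⇒⟦⟧≤<⟦suc⟧ : ∀ q s → + s ≡ ℚ.floor q → ⟦ s ⟧ ℚ.≤ q × q ℚ.< ⟦ suc s ⟧
  floor≡⇒⟦⟧≤<⟦suc⟧ (mkℚ num d _) s s≡⌊q⌋ rewrite ⟦⟧≡mkℚ s | ⟦⟧≡mkℚ (suc s) =
    ℚ.*≤* lower , ℚ.*<* upper
    where
    r = num ℤ.% + suc d
    num≡r+s*d : num ≡ + r ℤ.+ + s ℤ.* + suc d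
    num≡r+s*d = trans (ℤ.a≡a%n+[a/n]*n num (+ suc d)) (cong (λ z → + r ℤ.+ z ℤ.* + suc d) (sym s≡⌊q⌋))
    num≡num*1 : num ≡ num ℤ.* + 1
    num≡num*1 = sym (ℤ.*-identityʳ num)
    lower : + s ℤ.* + suc d ℤ.≤ num ℤ.* + 1
    lower = subst (_ ℤ.≤_) (trans (sym num≡r+s*d) num≡num*1) (ℤ.i≤j+i (+ s ℤ.* + suc d) (+ r))
    upper : num ℤ.* + 1 ℤ.< + suc s ℤ.* + suc d
    upper = subst₂ ℤ._<_ (trans (sym num≡r+s*d) num≡num*1) (sym (ℤ.suc-* (+ s) (+ suc d)))
              (ℤ.+-monoˡ-< (+ s ℤ.* + suc d) (ℤ.+<+ (ℤ.n%d<d num (+ suc d))))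

  ½-mono : ∀ {p q} → p ℚ.≤ q → ½ ℚ.- q ℚ.≤ ½ ℚ.- p
  ½-mono p≤q = ℚ.+-monoʳ-≤ ½ (ℚ.neg-antimono-≤ p≤q)

  2m*[½-1/m]*a+2a≡m*a : ∀ m .{{_ : NonZero m}} a →
    ⟦ 2 * m ⟧ ℚ.* ((½ ℚ.- 1/ℕ m) ℚ.* ⟦ a ⟧) ℚ.+ ⟦ 2 * a ⟧ ≡ ⟦ m * a ⟧
  2m*[½-1/m]*a+2a≡m*a m a = begin
    ⟦ 2 * m ⟧ ℚ.* ((½ ℚ.- 1/ℕ m) ℚ.* ⟦ a ⟧) ℚ.+ ⟦ 2 * a ⟧
      ≡⟨ cong₂ (λ x y → x ℚ.* ((½ ℚ.- 1/ℕ m) ℚ.* ⟦ a ⟧) ℚ.+ y) (⟦*⟧ 2 m) (⟦*⟧ 2 a) ⟨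
    ⟦ 2 ⟧ ℚ.* ⟦ m ⟧ ℚ.* ((½ ℚ.- 1/ℕ m) ℚ.* ⟦ a ⟧) ℚ.+ ⟦ 2 ⟧ ℚ.* ⟦ a ⟧
      ≡⟨ regroup ⟦ 2 ⟧ ½ (1/ℕ m) ⟦ m ⟧ ⟦ a ⟧ ⟩
    (⟦ 2 ⟧ ℚ.* ½) ℚ.* (⟦ m ⟧ ℚ.* ⟦ a ⟧) ℚ.+ (⟦ 2 ⟧ ℚ.* ⟦ a ⟧) ℚ.* (1ℚ ℚ.- ⟦ m ⟧ ℚ.* 1/ℕ m)
      ≡⟨ cong (λ x → 1ℚ ℚ.* (⟦ m ⟧ ℚ.* ⟦ a ⟧) ℚ.+ (⟦ 2 ⟧ ℚ.* ⟦ a ⟧) ℚ.* (1ℚ ℚ.- x))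
              (trans (ℚ.*-comm ⟦ m ⟧ (1/ℕ m)) (1/ℕ*⟦⟧≡1 m)) ⟩
    1ℚ ℚ.* (⟦ m ⟧ ℚ.* ⟦ a ⟧) ℚ.+ (⟦ 2 ⟧ ℚ.* ⟦ a ⟧) ℚ.* (1ℚ ℚ.- 1ℚ)
      ≡⟨ simplify (⟦ m ⟧ ℚ.* ⟦ a ⟧) (⟦ 2 ⟧ ℚ.* ⟦ a ⟧) ⟩
    ⟦ m ⟧ ℚ.* ⟦ a ⟧
      ≡⟨ ⟦*⟧ m a ⟩
    ⟦ m * a ⟧ ∎
    where
    open ≡-Reasoning
    open +-*-Solver using (solve; _:+_; _:-_; _:*_; _:=_; con)
    regroup : ∀ t h i K a → t ℚ.* K ℚ.* ((h ℚ.- i) ℚ.* a) ℚ.+ t ℚ.* a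
                          ≡ (t ℚ.* h) ℚ.* (K ℚ.* a) ℚ.+ (t ℚ.* a) ℚ.* (1ℚ ℚ.- K ℚ.* i)
    regroup = solve 5 (λ t h i K a → t :* K :* ((h :- i) :* a) :+ t :* a
                                  := (t :* h) :* (K :* a) :+ (t :* a) :* (con 1ℚ :- K :* i)) refl
    simplify : ∀ x y → 1ℚ ℚ.* x ℚ.+ y ℚ.* (1ℚ ℚ.- 1ℚ) ≡ x
    simplify = solve 2 (λ x y → con 1ℚ :* x :+ y :* (con 1ℚ :- con 1ℚ) := x) refl

  ℚ-+-cancelʳ-≤ : ∀ r {p q} → p ℚ.+ r ℚ.≤ q ℚ.+ r → p ℚ.≤ q
  ℚ-+-cancelʳ-≤ r {p} {q} = subst₂ ℚ._≤_ (+-∸ p) (+-∸ q) ∘ ℚ.+-monoˡ-≤ (ℚ.- r)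
    where
    +-∸ : ∀ x → x ℚ.+ r ℚ.- r ≡ x
    +-∸ x = trans (ℚ.+-assoc x r (ℚ.- r)) (trans (cong (x ℚ.+_) (ℚ.+-inverseʳ r)) (ℚ.+-identityʳ x))

  m*a≤2m*b+2a⇒[½-1/m]*a≤b : ∀ m .{{_ : NonZero m}} a b →
    m * a ≤ 2 * m * b + 2 * a → (½ ℚ.- 1/ℕ m) ℚ.* ⟦ a ⟧ ℚ.≤ ⟦ b ⟧
  m*a≤2m*b+2a⇒[½-1/m]*a≤b m a b ma≤2mb+2a =
    ℚ.*-cancelˡ-≤-pos ⟦ 2 * m ⟧ {{2m>0}} (ℚ-+-cancelʳ-≤ ⟦ 2 * a ⟧ (begin
      ⟦ 2 * m ⟧ ℚ.* ((½ ℚ.- 1/ℕ m) ℚ.* ⟦ a ⟧) ℚ.+ ⟦ 2 * a ⟧ ≡⟨ 2m*[½-1/m]*a+2a≡m*a m a ⟩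
      ⟦ m * a ⟧                                            ≤⟨ ⟦⟧-mono-≤ ma≤2mb+2a ⟩
      ⟦ 2 * m * b + 2 * a ⟧                                ≡⟨ ⟦+⟧ (2 * m * b) (2 * a) ⟨
      ⟦ 2 * m * b ⟧ ℚ.+ ⟦ 2 * a ⟧                          ≡⟨ cong (ℚ._+ ⟦ 2 * a ⟧) (⟦*⟧ (2 * m) b) ⟨
      ⟦ 2 * m ⟧ ℚ.* ⟦ b ⟧ ℚ.+ ⟦ 2 * a ⟧                    ∎))
    where
    open ℚ.≤-Reasoning
    2m>0 : ℚ.Positive ⟦ 2 * m ⟧
    2m>0 = ℚ.positive (ℚ.<-≤-trans (1/ℕ-pos 1)
                         (⟦⟧-mono-≤ {1} {2 * m} (≤-trans (>-nonZero⁻¹ m) (m≤n*m m 2))))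

  [½-1/m]*a≤b⇒m*a≤2m*b+2a : ∀ m .{{_ : NonZero m}} a b →
    (½ ℚ.- 1/ℕ m) ℚ.* ⟦ a ⟧ ℚ.≤ ⟦ b ⟧ → m * a ≤ 2 * m * b + 2 * a
  [½-1/m]*a≤b⇒m*a≤2m*b+2a m a b X≤b = ⟦⟧-cancel-≤ (begin
    ⟦ m * a ⟧                                            ≡⟨ 2m*[½-1/m]*a+2a≡m*a m a ⟨
    ⟦ 2 * m ⟧ ℚ.* ((½ ℚ.- 1/ℕ m) ℚ.* ⟦ a ⟧) ℚ.+ ⟦ 2 * a ⟧
      ≤⟨ ℚ.+-monoˡ-≤ ⟦ 2 * a ⟧ (⟦⟧*-mono-≤ (2 * m) X≤b) ⟩
    ⟦ 2 * m ⟧ ℚ.* ⟦ b ⟧ ℚ.+ ⟦ 2 * a ⟧                    ≡⟨ cong (ℚ._+ ⟦ 2 * a ⟧) (⟦*⟧ (2 * m) b) ⟩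
    ⟦ 2 * m * b ⟧ ℚ.+ ⟦ 2 * a ⟧                          ≡⟨ ⟦+⟧ (2 * m * b) (2 * a) ⟩
    ⟦ 2 * m * b + 2 * a ⟧                                ∎)
    where open ℚ.≤-Reasoning

  ⟦⟧≤[½-q]*⟦⟧⇒2*≤ : ∀ {q} s n → 0ℚ ℚ.≤ q → ⟦ s ⟧ ℚ.≤ (½ ℚ.- q) ℚ.* ⟦ n ⟧ → 2 * s ≤ n
  ⟦⟧≤[½-q]*⟦⟧⇒2*≤ {q} s n q≥0 s≤[½-q]n = ⟦⟧-cancel-≤ (begin
    ⟦ 2 * s ⟧                       ≡⟨ ⟦*⟧ 2 s ⟨
    ⟦ 2 ⟧ ℚ.* ⟦ s ⟧                  ≤⟨ ⟦⟧*-mono-≤ 2 s≤[½-q]n ⟩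
    ⟦ 2 ⟧ ℚ.* ((½ ℚ.- q) ℚ.* ⟦ n ⟧)  ≤⟨ ⟦⟧*-mono-≤ 2 (*⟦⟧-mono-≤ n ½-q≤½) ⟩
    ⟦ 2 ⟧ ℚ.* (½ ℚ.* ⟦ n ⟧)          ≡⟨ ℚ.*-assoc ⟦ 2 ⟧ ½ ⟦ n ⟧ ⟨
    1ℚ ℚ.* ⟦ n ⟧                    ≡⟨ ℚ.*-identityˡ ⟦ n ⟧ ⟩
    ⟦ n ⟧                           ∎)
    where
    open ℚ.≤-Reasoning
    ½-q≤½ : ½ ℚ.- q ℚ.≤ ½
    ½-q≤½ = subst (½ ℚ.- q ℚ.≤_) (ℚ.+-identityʳ ½) (½-mono q≥0)

  K*s≤K*deg+n : ∀ K .{{_ : NonZero K}} {q} s n d → q ℚ.≤ 1/ℕ K →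
    ⟦ s ⟧ ℚ.≤ (½ ℚ.- q) ℚ.* ⟦ n ⟧ → (½ ℚ.- ⟦ 2 ⟧ ℚ.* q) ℚ.* ⟦ n ⟧ ℚ.≤ ⟦ d ⟧ → K * s ≤ K * d + n
  K*s≤K*deg+n K {q} s n d q≤1/K s≤[½-q]n [½-2q]n≤d = ⟦⟧-cancel-≤ (begin
    ⟦ K * s ⟧                                   ≡⟨ ⟦*⟧ K s ⟨
    ⟦ K ⟧ ℚ.* ⟦ s ⟧                              ≤⟨ ⟦⟧*-mono-≤ K s≤[½-q]n ⟩
    ⟦ K ⟧ ℚ.* ((½ ℚ.- q) ℚ.* ⟦ n ⟧)              ≡⟨ cong (⟦ K ⟧ ℚ.*_) (split-off ½ q ⟦ n ⟧) ⟩
    ⟦ K ⟧ ℚ.* ((½ ℚ.- ⟦ 2 ⟧ ℚ.* q) ℚ.* ⟦ n ⟧ ℚ.+ q ℚ.* ⟦ n ⟧)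
      ≤⟨ ⟦⟧*-mono-≤ K (ℚ.+-mono-≤ [½-2q]n≤d (*⟦⟧-mono-≤ n q≤1/K)) ⟩
    ⟦ K ⟧ ℚ.* (⟦ d ⟧ ℚ.+ 1/ℕ K ℚ.* ⟦ n ⟧)          ≡⟨ ℚ.*-distribˡ-+ ⟦ K ⟧ ⟦ d ⟧ _ ⟩
    ⟦ K ⟧ ℚ.* ⟦ d ⟧ ℚ.+ ⟦ K ⟧ ℚ.* (1/ℕ K ℚ.* ⟦ n ⟧) ≡⟨ cong₂ ℚ._+_ (⟦*⟧ K d) (⟦⟧*[1/ℕ*]≡ K ⟦ n ⟧) ⟩
    ⟦ K * d ⟧ ℚ.+ ⟦ n ⟧                          ≡⟨ ⟦+⟧ (K * d) n ⟩
    ⟦ K * d + n ⟧                               ∎)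
    where
    open ℚ.≤-Reasoning
    open +-*-Solver using (solve; _:+_; _:-_; _:*_; _:=_; con)
    split-off : ∀ h q n → (h ℚ.- q) ℚ.* n ≡ (h ℚ.- (1ℚ ℚ.+ 1ℚ) ℚ.* q) ℚ.* n ℚ.+ q ℚ.* n
    split-off = solve 3 (λ h q n → (h :- q) :* n := (h :- (con 1ℚ :+ con 1ℚ) :* q) :* n :+ q :* n) refl

module Inequalities where

  open import Data.Bool using (true; false; T)
  open import Data.Empty using (⊥; ⊥-elim)
  open import Data.Nat
  open import Data.Nat.Properties
  import Data.Nat.DivMod as ℕ
  open import Data.Nat.Tactic.RingSolver using (solve-∀)
  open import Data.Sum using (_⊎_; inj₁; inj₂)
  open import Data.Unit using (tt)
  open import Relation.Binary.PropositionalEquality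
  open import Relation.Nullary using (yes; no)

  -- L ≤ R follows from X ≤ Y whenever L − R = X − Y − S with S ≥ 0. Below, X ≤ Y is always a
  -- combination of the hypotheses with nonnegative coefficients, and the polynomial identity
  -- certifying it is checked by the ring solver.
  ≤-by-certificate : ∀ {L R X Y} S → X ≤ Y → L + Y + S ≡ R + X → L ≤ R
  ≤-by-certificate {L} {R} {X} {Y} S X≤Y L+Y+S≡R+X = +-cancelʳ-≤ Y L R (begin
    L + Y     ≤⟨ m≤m+n (L + Y) S ⟩
    L + Y + S ≡⟨ L+Y+S≡R+X ⟩
    R + X     ≤⟨ +-monoʳ-≤ R X≤Y ⟩
    R + Y     ∎)
    where open ≤-Reasoning

  ≤-absurd-by-certificate : ∀ {X Y} S → X ≤ Y → 1 + Y + S ≡ X → ⊥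
  ≤-absurd-by-certificate S X≤Y 1+Y+S≡X with ≤-by-certificate {1} {0} S X≤Y 1+Y+S≡X
  ... | ()

  infixl 6 _⊕_
  _⊕_ : ∀ {a b c d} → a ≤ b → c ≤ d → a + c ≤ b + d
  _⊕_ = +-mono-≤

  infixr 7 _⊛_
  _⊛_ : ∀ k {a b} → a ≤ b → k * a ≤ k * b
  k ⊛ a≤b = *-monoʳ-≤ k a≤b

  n≤2[n/2]+1 : ∀ n → n ≤ 2 * (n ℕ./ 2) + 1
  n≤2[n/2]+1 n = begin
    n                             ≡⟨ ℕ.m≡m%n+[m/n]*n n 2 ⟩
    n ℕ.% 2 + n ℕ./ 2 * 2         ≤⟨ +-monoˡ-≤ _ (≤-pred (ℕ.m%n<n n 2)) ⟩
    1 + n ℕ./ 2 * 2               ≡⟨ trans (+-comm 1 _) (cong (_+ 1) (*-comm (n ℕ./ 2) 2)) ⟩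
    2 * (n ℕ./ 2) + 1             ∎
    where open ≤-Reasoning

  2*≤2*+1⇒≤ : ∀ {s h} → 2 * s ≤ 2 * h + 1 → s ≤ h
  2*≤2*+1⇒≤ {s} {h} 2s≤2h+1 = ≤-pred (*-cancelˡ-< 2 s (suc h) (begin-strict
    2 * s      ≤⟨ 2s≤2h+1 ⟩
    2 * h + 1  <⟨ ≤-reflexive (+-suc-double h) ⟩
    2 * suc h  ∎))
    where
    open ≤-Reasoning
    +-suc-double : ∀ h → suc (2 * h + 1) ≡ 2 * suc h
    +-suc-double = solve-∀

  half-covered⇒n≤4u : ∀ {n h u t K} → h ≤ u + t → n ≤ 2 * h + 1 → K * t ≤ 13 * n → 128 ≤ K → K ≤ n →
                 n ≤ 4 * u
  half-covered⇒n≤4u {n} {h} {u} {t} {K} h≤u+t n≤2h+1 Kt≤13n 128≤K K≤n = ≮⇒≥ λ 4u<n →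
    ≤-absurd-by-certificate 9599
      ((4 * K) ⊛ h≤u+t ⊕ (2 * K) ⊛ n≤2h+1 ⊕ 4 ⊛ Kt≤13n ⊕ K ⊛ 4u<n ⊕ 76 ⊛ K≤n ⊕ (n + 75) ⊛ 128≤K)
      (identity n h u t K)
    where
    identity : ∀ n h u t K →
      1 + (4 * K * (u + t) + 2 * K * (2 * h + 1) + 4 * (13 * n) + K * n + 76 * n + (n + 75) * K) + 9599
      ≡ 4 * K * h + 2 * K * n + 4 * (K * t) + K * suc (4 * u) + 76 * K + (n + 75) * 128
    identity = solve-∀

  n≤4[a+b]⇒n≤8a⊎n≤8b : ∀ {n a b} → n ≤ 4 * (a + b) → n ≤ 8 * a ⊎ n ≤ 8 * b
  n≤4[a+b]⇒n≤8a⊎n≤8b {n} {a} {b} n≤4[a+b] with n ≤? 8 * a | n ≤? 8 * b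
  ... | yes n≤8a | _        = inj₁ n≤8a
  ... | no _     | yes n≤8b = inj₂ n≤8b
  ... | no n≰8a  | no n≰8b  = ⊥-elim
    (≤-absurd-by-certificate 1 (2 ⊛ n≤4[a+b] ⊕ ≰⇒> n≰8a ⊕ ≰⇒> n≰8b) (identity n a b))
    where
    identity : ∀ n a b → 1 + (2 * (4 * (a + b)) + n + n) + 1 ≡ 2 * n + suc (8 * a) + suc (8 * b)
    identity = solve-∀

  sparse∧n≤8a⇒Kx<9n : ∀ {n a x e K} → a * (K * x) ≤ K * e + n * a → K * e < n * n → n ≤ 8 * a →
                      K * x < 9 * n
  sparse∧n≤8a⇒Kx<9n {n} {a} {x} {e} {K} row sparse n≤8a = *-cancelˡ-< a (K * x) (9 * n) (begin-strict
    a * (K * x)       ≤⟨ row ⟩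
    K * e + n * a     <⟨ +-monoˡ-< (n * a) sparse ⟩
    n * n + n * a     ≤⟨ +-monoˡ-≤ (n * a) (*-monoʳ-≤ n n≤8a) ⟩
    n * (8 * a) + n * a ≡⟨ identity n a ⟩
    a * (9 * n)       ∎)
    where
    open ≤-Reasoning
    identity : ∀ n a → n * (8 * a) + n * a ≡ a * (9 * n)
    identity = solve-∀

  sparse∧n≤4y⇒Kb<8n : ∀ {n b y e K} → b * (K * y) ≤ K * e + n * b → K * e < n * n → n ≤ 4 * y → b ≤ n →
                      K * b < 8 * n
  sparse∧n≤4y⇒Kb<8n {n} {b} {y} {e} {K} row sparse n≤4y b≤n = *-cancelˡ-< n (K * b) (8 * n) (begin-strict
    n * (K * b)           ≤⟨ *-monoˡ-≤ (K * b) n≤4y ⟩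
    4 * y * (K * b)       ≡⟨ identity y K b ⟩
    4 * (b * (K * y))     ≤⟨ 4 ⊛ row ⟩
    4 * (K * e + n * b)   <⟨ *-monoʳ-< 4 (+-monoˡ-< (n * b) sparse) ⟩
    4 * (n * n + n * b)   ≤⟨ 4 ⊛ +-monoʳ-≤ (n * n) (n ⊛ b≤n) ⟩
    4 * (n * n + n * n)   ≡⟨ double n ⟩
    n * (8 * n)           ∎)
    where
    open ≤-Reasoning
    identity : ∀ y K b → 4 * y * (K * b) ≡ 4 * (b * (K * y))
    identity = solve-∀
    double : ∀ n → 4 * (n * n + n * n) ≡ n * (8 * n)
    double = solve-∀

  K∣△∣≤24n : ∀ {n K d a b c h s} → d + 2 * a ≡ h + s → s ≤ h → h ≤ a + b + c → K * b < 8 * n →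
             K * c ≤ 4 * n → K * d ≤ 24 * n
  K∣△∣≤24n {n} {K} {d} {a} {b} {c} {h} {s} d+2a≡h+s s≤h h≤a+b+c Kb<8n Kc≤4n = ≤-by-certificate 2
    (K ⊛ ≤-reflexive d+2a≡h+s ⊕ K ⊛ s≤h ⊕ (2 * K) ⊛ h≤a+b+c ⊕ 2 ⊛ Kb<8n ⊕ 2 ⊛ Kc≤4n)
    (identity n K d a b c h s)
    where
    identity : ∀ n K d a b c h s →
      K * d + (K * (h + s) + K * h + 2 * K * (a + b + c) + 2 * (8 * n) + 2 * (4 * n)) + 2
      ≡ 24 * n + (K * (d + 2 * a) + K * s + 2 * K * h + 2 * suc (K * b) + 2 * (K * c))
    identity = solve-∀

  K∣C∣≤4n : ∀ {n K s c} → s + s + c ≡ n → K * n ≤ 2 * K * suc s + 2 * n → K ≤ n → K * c ≤ 4 * n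
  K∣C∣≤4n {n} {K} {s} {c} s+s+c≡n Kn≤2K[1+s]+2n K≤n = ≤-by-certificate 0
    (K ⊛ ≤-reflexive s+s+c≡n ⊕ Kn≤2K[1+s]+2n ⊕ 2 ⊛ K≤n)
    (identity n K s c)
    where
    identity : ∀ n K s c →
      K * c + (K * n + (2 * K * suc s + 2 * n) + 2 * n) + 0 ≡ 4 * n + (K * (s + s + c) + K * n + 2 * K)
    identity = solve-∀

  K∣△∣≤56n : ∀ {n K Δ u w c c′} → Δ ≤ u + w + c + c′ → K * u ≤ 24 * n → K * w ≤ 24 * n →
             K * c ≤ 4 * n → K * c′ ≤ 4 * n → K * Δ ≤ 56 * n
  K∣△∣≤56n {n} {K} {Δ} {u} {w} {c} {c′} Δ≤ Ku≤ Kw≤ Kc≤ Kc′≤ = ≤-by-certificate 0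
    (K ⊛ Δ≤ ⊕ Ku≤ ⊕ Kw≤ ⊕ Kc≤ ⊕ Kc′≤)
    (identity n K Δ u w c c′)
    where
    identity : ∀ n K Δ u w c c′ →
      K * Δ + (K * (u + w + c + c′) + 24 * n + 24 * n + 4 * n + 4 * n) + 0
      ≡ 56 * n + (K * Δ + K * u + K * w + K * c + K * c′)
    identity = solve-∀

  crossing-absurd : ∀ {n K D Δ} → 128 * D ≤ K → n ≤ D * Δ → K * Δ ≤ 56 * n → 1 ≤ n → 1 ≤ D → ⊥
  crossing-absurd {n} {K} {D} {Δ} 128D≤K n≤DΔ KΔ≤56n 1≤n 1≤D = ≤-absurd-by-certificate 71
    (n ⊛ 128D≤K ⊕ K ⊛ n≤DΔ ⊕ D ⊛ KΔ≤56n ⊕ (72 * D) ⊛ 1≤n ⊕ 72 ⊛ 1≤D)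
    (identity n K D Δ)
    where
    identity : ∀ n K D Δ →
      1 + (n * K + K * (D * Δ) + D * (56 * n) + 72 * D * n + 72 * D) + 71
      ≡ n * (128 * D) + K * n + D * (K * Δ) + 72 * D * 1 + 72 * 1
    identity = solve-∀

  m*n≤2m*h+2n : ∀ {m n h} → n ≤ 2 * h + 1 → m ≤ n → m * n ≤ 2 * m * h + 2 * n
  m*n≤2m*h+2n {m} {n} {h} n≤2h+1 m≤n = ≤-by-certificate n (m ⊛ n≤2h+1 ⊕ m≤n) (identity m n h)
    where
    identity : ∀ m n h → m * n + (m * (2 * h + 1) + n) + n ≡ 2 * m * h + 2 * n + (m * n + m)
    identity = solve-∀

  ≤ᵇ≡true⇒≤ : ∀ {a b} → (a ≤ᵇ b) ≡ true → a ≤ b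
  ≤ᵇ≡true⇒≤ {a} {b} a≤ᵇb = ≤ᵇ⇒≤ a b (subst T (sym a≤ᵇb) tt)

  ≤ᵇ≡false⇒> : ∀ {a b} → (a ≤ᵇ b) ≡ false → b < a
  ≤ᵇ≡false⇒> a≰ᵇb = ≰⇒> (λ a≤b → subst T a≰ᵇb (≤⇒≤ᵇ a≤b))

module Stability where

  open import Defs
  open Counting
  open Rationals
  open Inequalities
  open import Data.Bool using (Bool; true; false)
  open import Data.Empty using (⊥)
  open import Data.Fin using (Fin)
  open import Data.Fin.Subset using (Subset; ∣_∣; _∩_)
  open import Data.Fin.Subset.Properties using (∣p∣≤n)
  open import Data.Integer as ℤ using (+_)
  import Data.Integer.Properties as ℤ
  open import Data.Nat
  open import Data.Nat.Properties
  import Data.Nat.DivMod as ℕ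
  open import Data.Nat.Tactic.RingSolver using (solve-∀)
  open import Data.Product using (_×_; _,_; proj₁; proj₂)
  open import Data.Rational as ℚ using (↧ₙ_; ½; 0ℚ)
  import Data.Rational.Properties as ℚ
  open import Data.Sum as Sum using (_⊎_; inj₁; inj₂)
  open import Data.Vec using (lookup)
  open import Function using (_∘_)
  open import Relation.Binary.PropositionalEquality
  open import Relation.Nullary using (¬_)

  -- What a characteristic partition for parameter ε gives when ε ≤ 1/K and K ≤ n, in integer
  -- form: s = ⌊(½ − ε)n⌋, the leftover parts C₁, C₂ have at most 4n/K vertices, and degrees into
  -- the partner part are at least s − n/K.
  record Characteristicℕ {n} (K : ℕ) (G : BipGraph n) (P : Partition n) : Set where
    field
      s         : ℕ
      split₁    : Splits (A₁ P) (B₁ P) (C₁ P)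
      split₂    : Splits (A₂ P) (B₂ P) (C₂ P)
      ∣A₁∣≡s    : ∣ A₁ P ∣ ≡ s
      ∣B₁∣≡s    : ∣ B₁ P ∣ ≡ s
      ∣A₂∣≡s    : ∣ A₂ P ∣ ≡ s
      ∣B₂∣≡s    : ∣ B₂ P ∣ ≡ s
      2s≤n      : 2 * s ≤ n
      K∣C₁∣≤4n  : K * ∣ C₁ P ∣ ≤ 4 * n
      K∣C₂∣≤4n  : K * ∣ C₂ P ∣ ≤ 4 * n
      A₁→A₂     : ∀ v → lookup (A₁ P) v ≡ true → K * s ≤ K * deg₁ G v (A₂ P) + n
      B₁→B₂     : ∀ v → lookup (B₁ P) v ≡ true → K * s ≤ K * deg₁ G v (B₂ P) + n

  -- Exchanging the roles of A and B lets every statement about A₁ be reused for B₁.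
  swapAB : ∀ {n} → Partition n → Partition n
  swapAB P = record { A₁ = B₁ P ; B₁ = A₁ P ; C₁ = C₁ P ; A₂ = B₂ P ; B₂ = A₂ P ; C₂ = C₂ P }

  Characteristicℕ-swapAB : ∀ {n K} {G : BipGraph n} {P} →
                           Characteristicℕ K G P → Characteristicℕ K G (swapAB P)
  Characteristicℕ-swapAB χ = record
    { s = s ; split₁ = Splits-swap split₁ ; split₂ = Splits-swap split₂
    ; ∣A₁∣≡s = ∣B₁∣≡s ; ∣B₁∣≡s = ∣A₁∣≡s ; ∣A₂∣≡s = ∣B₂∣≡s ; ∣B₂∣≡s = ∣A₂∣≡s
    ; 2s≤n = 2s≤n ; K∣C₁∣≤4n = K∣C₁∣≤4n ; K∣C₂∣≤4n = K∣C₂∣≤4n ; A₁→A₂ = B₁→B₂ ; B₁→B₂ = A₁→A₂ }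
    where open Characteristicℕ χ

  Characteristic⇒Characteristicℕ : ∀ {n ε} K .{{_ : NonZero K}} {G : BipGraph n} {P} →
    0ℚ ℚ.< ε → ε ℚ.≤ 1/ℕ K → K ≤ n → Characteristic n ε G P → Characteristicℕ K G P
  Characteristic⇒Characteristicℕ {n} {ε} K {G} {P} ε>0 ε≤1/K K≤n
    (part₁ , part₂ , A₁≡⌊⌋ , B₁≡⌊⌋ , A₂≡⌊⌋ , B₂≡⌊⌋ , _ , degA₁ , _ , degB₁ , _) = record
    { s = s
    ; split₁ = split₁ ; split₂ = split₂
    ; ∣A₁∣≡s = refl
    ; ∣B₁∣≡s = ∣B₁∣≡s ; ∣A₂∣≡s = ∣A₂∣≡s ; ∣B₂∣≡s = ∣B₂∣≡s
    ; 2s≤n = ⟦⟧≤[½-q]*⟦⟧⇒2*≤ s n (ℚ.<⇒≤ ε>0) s≤[½-ε]n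
    ; K∣C₁∣≤4n = K∣C∣≤4n (size split₁ refl ∣B₁∣≡s) Kn≤2K[1+s]+2n K≤n
    ; K∣C₂∣≤4n = K∣C∣≤4n (size split₂ ∣A₂∣≡s ∣B₂∣≡s) Kn≤2K[1+s]+2n K≤n
    ; A₁→A₂ = λ v v∈A₁ → K*s≤K*deg+n K s n _ ε≤1/K s≤[½-ε]n (degA₁ v v∈A₁)
    ; B₁→B₂ = λ v v∈B₁ → K*s≤K*deg+n K s n _ ε≤1/K s≤[½-ε]n (degB₁ v v∈B₁)
    }
    where
    s : ℕ
    s = ∣ A₁ P ∣
    split₁ : Splits (A₁ P) (B₁ P) (C₁ P)
    split₁ = IsPartition3⇒Splits part₁
    split₂ : Splits (A₂ P) (B₂ P) (C₂ P)
    split₂ = IsPartition3⇒Splits part₂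
    same-floor : ∀ X → + ∣ X ∣ ≡ ℚ.floor ((½ ℚ.- ε) ℚ.* ⟦ n ⟧) → ∣ X ∣ ≡ s
    same-floor X X≡⌊⌋ = ℤ.+-injective (trans X≡⌊⌋ (sym A₁≡⌊⌋))
    ∣B₁∣≡s : ∣ B₁ P ∣ ≡ s
    ∣B₁∣≡s = same-floor (B₁ P) B₁≡⌊⌋
    ∣A₂∣≡s : ∣ A₂ P ∣ ≡ s
    ∣A₂∣≡s = same-floor (A₂ P) A₂≡⌊⌋
    ∣B₂∣≡s : ∣ B₂ P ∣ ≡ s
    ∣B₂∣≡s = same-floor (B₂ P) B₂≡⌊⌋
    floor-bounds : ⟦ s ⟧ ℚ.≤ (½ ℚ.- ε) ℚ.* ⟦ n ⟧ × (½ ℚ.- ε) ℚ.* ⟦ n ⟧ ℚ.< ⟦ suc s ⟧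
    floor-bounds = floor≡⇒⟦⟧≤<⟦suc⟧ ((½ ℚ.- ε) ℚ.* ⟦ n ⟧) s A₁≡⌊⌋
    s≤[½-ε]n : ⟦ s ⟧ ℚ.≤ (½ ℚ.- ε) ℚ.* ⟦ n ⟧
    s≤[½-ε]n = proj₁ floor-bounds
    Kn≤2K[1+s]+2n : K * n ≤ 2 * K * suc s + 2 * n
    Kn≤2K[1+s]+2n = [½-1/m]*a≤b⇒m*a≤2m*b+2a K n (suc s)
      (ℚ.≤-trans (*⟦⟧-mono-≤ n (½-mono ε≤1/K)) (ℚ.<⇒≤ (proj₂ floor-bounds)))
    size : ∀ {X Y Z} → Splits X Y Z → ∣ X ∣ ≡ s → ∣ Y ∣ ≡ s → s + s + ∣ Z ∣ ≡ n
    size split X≡s Y≡s = trans (cong₂ (λ x y → x + y + _) (sym X≡s) (sym Y≡s)) (Splits⇒∣∣+∣∣+∣∣≡n split)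

  module _ {n K h} (A B : Subset n) (∣A∣≡h : ∣ A ∣ ≡ h) (∣B∣≡h : ∣ B ∣ ≡ h) (n≤2h+1 : n ≤ 2 * h + 1)
           (128≤K : 128 ≤ K) (K≤n : K ≤ n) where

    module _ {G : BipGraph n} {P : Partition n} (χ : Characteristicℕ K G P)
             (sparse : K * e G A B < n * n) where

      open Characteristicℕ χ

      A-covered : h ≤ ∣ A ∩ A₁ P ∣ + ∣ A ∩ B₁ P ∣ + ∣ C₁ P ∣
      A-covered = subst (_≤ ∣ A ∩ A₁ P ∣ + ∣ A ∩ B₁ P ∣ + ∣ C₁ P ∣) ∣A∣≡h (Splits⇒∣∣≤∣∩∣+∣∩∣+∣∣ split₁ A)

      n≤4∣A∩[A₁∪B₁]∣ : n ≤ 4 * (∣ A ∩ A₁ P ∣ + ∣ A ∩ B₁ P ∣)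
      n≤4∣A∩[A₁∪B₁]∣ = half-covered⇒n≤4u {u = ∣ A ∩ A₁ P ∣ + ∣ A ∩ B₁ P ∣} {t = ∣ C₁ P ∣} {K = K}
        A-covered n≤2h+1
        (≤-trans K∣C₁∣≤4n (*-monoˡ-≤ n {4} {13} (s≤s (s≤s (s≤s (s≤s z≤n)))))) 128≤K K≤n

      sparse∧n≤8∣A∩A₁∣⇒A≈A₁ : n ≤ 8 * ∣ A ∩ A₁ P ∣ → K * ∣ A △ A₁ P ∣ ≤ 24 * n
      sparse∧n≤8∣A∩A₁∣⇒A≈A₁ n≤8a = K∣△∣≤24n {n} {K} {a = ∣ A ∩ A₁ P ∣} {b} {∣ C₁ P ∣} {h} {s}
        (trans (∣△∣+2∣∩∣≡∣∣+∣∣ A (A₁ P)) (cong₂ _+_ ∣A∣≡h ∣A₁∣≡s))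
        (2*≤2*+1⇒≤ (≤-trans 2s≤n n≤2h+1)) A-covered K*b<8n K∣C₁∣≤4n
        where
        b x y : ℕ
        b = ∣ A ∩ B₁ P ∣
        x = ∣ B ∩ A₂ P ∣
        y = ∣ B ∩ B₂ P ∣
        row-bound : ∀ X Y → e G (A ∩ X) B ≤ e G A B → ∣ Y ∣ ≡ s →
                    (∀ v → lookup X v ≡ true → K * s ≤ K * deg₁ G v Y + n) →
                    ∣ A ∩ X ∣ * (K * ∣ B ∩ Y ∣) ≤ K * e G A B + n * ∣ A ∩ X ∣
        row-bound X Y e∩≤e ∣Y∣≡s dense =
          ≤-trans (∣∩∣*K∣∩∣≤Ke+t∣∩∣ G K n ∣Y∣≡s dense A B) (+-monoˡ-≤ _ (*-monoʳ-≤ K e∩≤e))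
        e-∩A₁+e-∩B₁≤e : e G (A ∩ A₁ P) B + e G (A ∩ B₁ P) B ≤ e G A B
        e-∩A₁+e-∩B₁≤e = Splits⇒e-∩+e-∩≤e split₁ G A B
        K*x<9n : K * x < 9 * n
        K*x<9n = sparse∧n≤8a⇒Kx<9n {n} {∣ A ∩ A₁ P ∣} {x} {e G A B} {K}
          (row-bound (A₁ P) (A₂ P) (≤-trans (m≤m+n _ _) e-∩A₁+e-∩B₁≤e) ∣A₂∣≡s A₁→A₂) sparse n≤8a
        B-covered : h ≤ y + (x + ∣ C₂ P ∣)
        B-covered = subst (_≤ y + (x + ∣ C₂ P ∣)) ∣B∣≡h (≤-trans (Splits⇒∣∣≤∣∩∣+∣∩∣+∣∣ split₂ B)
          (≤-reflexive (trans (cong (_+ ∣ C₂ P ∣) (+-comm x y)) (+-assoc y x _))))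
        K*[x+c₂]≤13n : K * (x + ∣ C₂ P ∣) ≤ 13 * n
        K*[x+c₂]≤13n = begin
          K * (x + ∣ C₂ P ∣)        ≡⟨ *-distribˡ-+ K x _ ⟩
          K * x + K * ∣ C₂ P ∣      ≤⟨ +-mono-≤ (<⇒≤ K*x<9n) K∣C₂∣≤4n ⟩
          9 * n + 4 * n            ≡⟨ *-distribʳ-+ n 9 4 ⟨
          13 * n                   ∎
          where open ≤-Reasoning
        n≤4y : n ≤ 4 * y
        n≤4y = half-covered⇒n≤4u {u = y} {t = x + ∣ C₂ P ∣} {K = K}
          B-covered n≤2h+1 K*[x+c₂]≤13n 128≤K K≤n
        K*b<8n : K * b < 8 * n
        K*b<8n = sparse∧n≤4y⇒Kb<8n {n} {b} {y} {e G A B} {K}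
          (row-bound (B₁ P) (B₂ P) (≤-trans (m≤n+m _ _) e-∩A₁+e-∩B₁≤e) ∣B₂∣≡s B₁→B₂)
          sparse n≤4y (∣p∣≤n (A ∩ B₁ P))

    sparse⇒A≈A₁⊎A≈B₁ : ∀ {G : BipGraph n} {P} → Characteristicℕ K G P → K * e G A B < n * n →
                       K * ∣ A △ A₁ P ∣ ≤ 24 * n ⊎ K * ∣ A △ B₁ P ∣ ≤ 24 * n
    sparse⇒A≈A₁⊎A≈B₁ {P = P} χ sparse =
      Sum.map (sparse∧n≤8∣A∩A₁∣⇒A≈A₁ χ sparse)
              (sparse∧n≤8∣A∩A₁∣⇒A≈A₁ (Characteristicℕ-swapAB χ) sparse)
        (n≤4[a+b]⇒n≤8a⊎n≤8b {a = ∣ A ∩ A₁ P ∣} {∣ A ∩ B₁ P ∣} (n≤4∣A∩[A₁∪B₁]∣ χ sparse))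

    sparse-pair⇒A₁≈A₁⊎A₁≈B₁ : ∀ {Gᵢ Gⱼ : BipGraph n} {Pᵢ Pⱼ} →
      Characteristicℕ K Gᵢ Pᵢ → Characteristicℕ K Gⱼ Pⱼ → K * e Gᵢ A B < n * n → K * e Gⱼ A B < n * n →
      K * ∣ A₁ Pᵢ △ A₁ Pⱼ ∣ ≤ 56 * n ⊎ K * ∣ A₁ Pᵢ △ B₁ Pⱼ ∣ ≤ 56 * n
    sparse-pair⇒A₁≈A₁⊎A₁≈B₁ {Pᵢ = Pᵢ} {Pⱼ} χᵢ χⱼ sparseᵢ sparseⱼ =
      cases (sparse⇒A≈A₁⊎A≈B₁ χᵢ sparseᵢ) (sparse⇒A≈A₁⊎A≈B₁ χⱼ sparseⱼ)
      where
      open Characteristicℕ using (split₁; K∣C₁∣≤4n)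
      ≤-+-+ : ∀ {Δ m c c′} → Δ ≤ m → Δ ≤ m + c + c′
      ≤-+-+ {Δ} {m} {c} {c′} Δ≤m = ≤-trans Δ≤m (≤-trans (m≤m+n m c) (m≤m+n (m + c) c′))
      combine : ∀ {Δ u w} → Δ ≤ u + w + ∣ C₁ Pᵢ ∣ + ∣ C₁ Pⱼ ∣ → K * u ≤ 24 * n → K * w ≤ 24 * n →
                K * Δ ≤ 56 * n
      combine {Δ} {u} {w} Δ≤ Ku≤ Kw≤ =
        K∣△∣≤56n {n} {K} {Δ} {u} {w} Δ≤ Ku≤ Kw≤ (K∣C₁∣≤4n χᵢ) (K∣C₁∣≤4n χⱼ)
      cases : K * ∣ A △ A₁ Pᵢ ∣ ≤ 24 * n ⊎ K * ∣ A △ B₁ Pᵢ ∣ ≤ 24 * n →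
              K * ∣ A △ A₁ Pⱼ ∣ ≤ 24 * n ⊎ K * ∣ A △ B₁ Pⱼ ∣ ≤ 24 * n →
              K * ∣ A₁ Pᵢ △ A₁ Pⱼ ∣ ≤ 56 * n ⊎ K * ∣ A₁ Pᵢ △ B₁ Pⱼ ∣ ≤ 56 * n
      cases (inj₁ A≈A₁ᵢ) (inj₁ A≈A₁ⱼ) =
        inj₁ (combine (≤-+-+ (∣△∣≤∣△∣+∣△∣ A (A₁ Pᵢ) (A₁ Pⱼ))) A≈A₁ᵢ A≈A₁ⱼ)
      cases (inj₁ A≈A₁ᵢ) (inj₂ A≈B₁ⱼ) =
        inj₂ (combine (≤-+-+ (∣△∣≤∣△∣+∣△∣ A (A₁ Pᵢ) (B₁ Pⱼ))) A≈A₁ᵢ A≈B₁ⱼ)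
      cases (inj₂ A≈B₁ᵢ) (inj₁ A≈A₁ⱼ) = inj₂ (combine
        (≤-trans (Splits⇒∣△∣≤∣△∣+∣∣+∣∣ (split₁ χᵢ) (Splits-swap (split₁ χⱼ)))
                 (+-monoˡ-≤ _ (+-monoˡ-≤ _ (∣△∣≤∣△∣+∣△∣ A (B₁ Pᵢ) (A₁ Pⱼ))))) A≈B₁ᵢ A≈A₁ⱼ)
      cases (inj₂ A≈B₁ᵢ) (inj₂ A≈B₁ⱼ) = inj₁ (combine
        (≤-trans (Splits⇒∣△∣≤∣△∣+∣∣+∣∣ (split₁ χᵢ) (split₁ χⱼ))
                 (+-monoˡ-≤ _ (+-monoˡ-≤ _ (∣△∣≤∣△∣+∣△∣ A (B₁ Pᵢ) (B₁ Pⱼ))))) A≈B₁ᵢ A≈B₁ⱼ)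

    sparse-pair⇒¬Crossing : ∀ {Gᵢ Gⱼ : BipGraph n} {Pᵢ Pⱼ δ} → 0ℚ ℚ.< δ → 128 * ↧ₙ δ ≤ K →
      Characteristicℕ K Gᵢ Pᵢ → Characteristicℕ K Gⱼ Pⱼ → K * e Gᵢ A B < n * n → K * e Gⱼ A B < n * n →
      ¬ Crossing n δ Pᵢ Pⱼ
    sparse-pair⇒¬Crossing {Pᵢ = Pᵢ} {Pⱼ} {δ} δ>0 128↧δ≤K χᵢ χⱼ sparseᵢ sparseⱼ (δn≤∣A₁△A₁∣ , δn≤∣A₁△B₁∣) =
      Sum.[ contradict ∣ A₁ Pᵢ △ A₁ Pⱼ ∣ δn≤∣A₁△A₁∣ , contradict ∣ A₁ Pᵢ △ B₁ Pⱼ ∣ δn≤∣A₁△B₁∣ ]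
        (sparse-pair⇒A₁≈A₁⊎A₁≈B₁ χᵢ χⱼ sparseᵢ sparseⱼ)
      where
      contradict : ∀ Δ → δ ℚ.* ⟦ n ⟧ ℚ.≤ ⟦ Δ ⟧ → K * Δ ≤ 56 * n → ⊥
      contradict Δ δn≤Δ KΔ≤56n = crossing-absurd 128↧δ≤K (q*⟦a⟧≤⟦b⟧⇒a≤↧ₙq*b δ δ>0 n Δ δn≤Δ) KΔ≤56n
        (≤-trans (≤-trans (s≤s z≤n) 128≤K) K≤n) (s≤s z≤n)

  ⌊n/2⌋≥[½-α]n : ∀ {n α} → 0ℚ ℚ.< α → ↧ₙ α ≤ n → (½ ℚ.- α) ℚ.* ⟦ n ⟧ ℚ.≤ ⟦ n ℕ./ 2 ⟧
  ⌊n/2⌋≥[½-α]n {n} {α} α>0 ↧α≤n = ℚ.≤-trans (*⟦⟧-mono-≤ n (½-mono (1/↧ₙ≤ α α>0)))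
    (m*a≤2m*b+2a⇒[½-1/m]*a≤b (↧ₙ α) n (n ℕ./ 2) (m*n≤2m*h+2n {h = n ℕ./ 2} (n≤2[n/2]+1 n) ↧α≤n))

  strongly-stable⇒n³≤ : ∀ {n γ α} {𝒢 : Collection n} → 0ℚ ℚ.< γ → 0ℚ ℚ.< α → ↧ₙ α ≤ n →
    StronglyStable n γ α 𝒢 → ∀ A B → ∣ A ∣ ≡ n ℕ./ 2 → ∣ B ∣ ≡ n ℕ./ 2 →
    n ^ 3 ≤ ↧ₙ γ * ↧ₙ α * ∑ (λ i → e (𝒢 i) A B)
  strongly-stable⇒n³≤ {n} {γ} {α} {𝒢} γ>0 α>0 ↧α≤n (I , nice , γn≤∣I∣) A B ∣A∣≡h ∣B∣≡h = begin
    n * n ^ 2                      ≤⟨ *-monoˡ-≤ (n ^ 2) (q*⟦a⟧≤⟦b⟧⇒a≤↧ₙq*b γ γ>0 n ∣ I ∣ γn≤∣I∣) ⟩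
    ↧ₙ γ * ∣ I ∣ * n ^ 2           ≡⟨ *-assoc (↧ₙ γ) ∣ I ∣ (n ^ 2) ⟩
    ↧ₙ γ * (∣ I ∣ * n ^ 2)         ≤⟨ *-monoʳ-≤ (↧ₙ γ) (∣∣*≤∑ I n²≤↧α*e) ⟩
    ↧ₙ γ * ∑ (λ i → ↧ₙ α * e (𝒢 i) A B) ≡⟨ cong (↧ₙ γ *_) (∑-*ˡ (↧ₙ α) (λ i → e (𝒢 i) A B)) ⟩
    ↧ₙ γ * (↧ₙ α * ∑ (λ i → e (𝒢 i) A B)) ≡⟨ *-assoc (↧ₙ γ) (↧ₙ α) _ ⟨
    ↧ₙ γ * ↧ₙ α * ∑ (λ i → e (𝒢 i) A B)  ∎
    where
    open ≤-Reasoning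
    large : ∀ X → ∣ X ∣ ≡ n ℕ./ 2 → (½ ℚ.- α) ℚ.* ⟦ n ⟧ ℚ.≤ ⟦ ∣ X ∣ ⟧
    large X ∣X∣≡⌊n/2⌋ = subst (λ m → _ ℚ.≤ ⟦ m ⟧) (sym ∣X∣≡⌊n/2⌋) (⌊n/2⌋≥[½-α]n α>0 ↧α≤n)
    n²≤↧α*e : ∀ i → lookup I i ≡ true → n ^ 2 ≤ ↧ₙ α * e (𝒢 i) A B
    n²≤↧α*e i i∈I = q*⟦a⟧≤⟦b⟧⇒a≤↧ₙq*b α α>0 (n ^ 2) (e (𝒢 i) A B)
      (nice i i∈I A B (large A ∣A∣≡h) (large B ∣B∣≡h))

  weakly-stable⇒n³≤ : ∀ {n ε δ} {𝒢 : Collection n} K .{{_ : NonZero K}} →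
    0ℚ ℚ.< ε → ε ℚ.≤ 1/ℕ K → 0ℚ ℚ.< δ → 128 * ↧ₙ δ ≤ K → K ≤ n →
    WeaklyStable n ε δ 𝒢 → ∀ A B → ∣ A ∣ ≡ n ℕ./ 2 → ∣ B ∣ ≡ n ℕ./ 2 →
    n ^ 3 ≤ 2 * ↧ₙ δ * K * ∑ (λ i → e (𝒢 i) A B)
  weakly-stable⇒n³≤ {n} {ε} {δ} {𝒢} K ε>0 ε≤1/K δ>0 128↧δ≤K K≤n
    (P , characteristic , E , cross , δn²≤∑∣E∣) A B ∣A∣≡⌊n/2⌋ ∣B∣≡⌊n/2⌋ = begin
    n * n ^ 2               ≤⟨ *-monoˡ-≤ (n ^ 2) n≤2↧δ*g ⟩
    2 * ↧ₙ δ * g * n ^ 2    ≡⟨ *-assoc (2 * ↧ₙ δ) g (n ^ 2) ⟩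
    2 * ↧ₙ δ * (g * n ^ 2)  ≤⟨ *-monoʳ-≤ (2 * ↧ₙ δ) g*n²≤K*S ⟩
    2 * ↧ₙ δ * (K * S)      ≡⟨ *-assoc (2 * ↧ₙ δ) K S ⟨
    2 * ↧ₙ δ * K * S        ∎
    where
    open ≤-Reasoning
    S : ℕ
    S = ∑ (λ i → e (𝒢 i) A B)
    n²≡n*n : n ^ 2 ≡ n * n
    n²≡n*n = cong (n *_) (*-identityʳ n)
    1≤n : 1 ≤ n
    1≤n = ≤-trans (>-nonZero⁻¹ K) K≤n
    heavy : Fin n → Bool
    heavy i = n * n ≤ᵇ K * e (𝒢 i) A B
    g : ℕ
    g = ∑ (𝟙 ∘ heavy)
    g*n²≤K*S : g * n ^ 2 ≤ K * S
    g*n²≤K*S = subst₂ _≤_ (cong (g *_) (sym n²≡n*n)) (∑-*ˡ K (λ i → e (𝒢 i) A B))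
      (∑𝟙*≤∑ heavy (λ i → ≤ᵇ≡true⇒≤))
    χ : ∀ ℓ → Extremal n ε (𝒢 ℓ) → Characteristicℕ K (𝒢 ℓ) (P ℓ)
    χ ℓ extremal = Characteristic⇒Characteristicℕ K ε>0 ε≤1/K K≤n (characteristic ℓ extremal)
    no-light-crossing : ∀ i j → lookup (E i) j ≡ true → heavy i ≡ false → heavy j ≡ false → ⊥
    no-light-crossing i j ij∈E light-i light-j = absurd (cross i j ij∈E)
      where
      absurd : CrossEdge n ε δ 𝒢 P i j → ⊥
      absurd (_ , extremal-i , extremal-j , crossing) =
        sparse-pair⇒¬Crossing A B ∣A∣≡⌊n/2⌋ ∣B∣≡⌊n/2⌋ (n≤2[n/2]+1 n)
          (≤-trans (m≤m*n 128 (↧ₙ δ)) 128↧δ≤K) K≤n δ>0 128↧δ≤K (χ i extremal-i) (χ j extremal-j)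
          (≤ᵇ≡false⇒> light-i) (≤ᵇ≡false⇒> light-j) crossing
    n≤2↧δ*g : n ≤ 2 * ↧ₙ δ * g
    n≤2↧δ*g = *-cancelˡ-≤ n {{>-nonZero 1≤n}} (begin
      n * n                       ≡⟨ n²≡n*n ⟨
      n ^ 2                       ≤⟨ q*⟦a⟧≤⟦b⟧⇒a≤↧ₙq*b δ δ>0 (n ^ 2) _ δn²≤∑∣E∣ ⟩
      ↧ₙ δ * ∑ (λ i → ∣ E i ∣)    ≤⟨ *-monoʳ-≤ (↧ₙ δ) (∑∣∣≤2n∑𝟙 E heavy no-light-crossing) ⟩
      ↧ₙ δ * (2 * n * g)          ≡⟨ rearrange (↧ₙ δ) n g ⟩
      n * (2 * ↧ₙ δ * g)          ∎)
      where
      rearrange : ∀ d n g → d * (2 * n * g) ≡ n * (2 * d * g)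
      rearrange = solve-∀

  stable⇒n³≤ : ∀ {n γ α ε δ} {𝒢 : Collection n} → 0ℚ ℚ.< γ → 0ℚ ℚ.< α → 0ℚ ℚ.< ε → 0ℚ ℚ.< δ →
    ε ℚ.≤ 1/ℕ (128 * ↧ₙ δ) → 128 * ↧ₙ δ + ↧ₙ α ≤ n → Stable n γ α ε δ 𝒢 →
    ∀ A B → ∣ A ∣ ≡ n ℕ./ 2 → ∣ B ∣ ≡ n ℕ./ 2 →
    n ^ 3 ≤ 2 * ↧ₙ δ * (128 * ↧ₙ δ) * (↧ₙ γ * ↧ₙ α) * ∑ (λ i → e (𝒢 i) A B)
  stable⇒n³≤ {n} {γ} {α} {ε} {δ} {𝒢} γ>0 α>0 ε>0 δ>0 ε≤1/K K+↧α≤n stable A B ∣A∣≡h ∣B∣≡h =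
    Sum.[ from-strong , from-weak ] stable
    where
    K S : ℕ
    K = 128 * ↧ₙ δ
    S = ∑ (λ i → e (𝒢 i) A B)
    from-strong : StronglyStable n γ α 𝒢 → n ^ 3 ≤ 2 * ↧ₙ δ * K * (↧ₙ γ * ↧ₙ α) * S
    from-strong strong =
      ≤-trans (strongly-stable⇒n³≤ γ>0 α>0 (≤-trans (m≤n+m _ K) K+↧α≤n) strong A B ∣A∣≡h ∣B∣≡h)
              (*-monoˡ-≤ S (m≤n*m (↧ₙ γ * ↧ₙ α) (2 * ↧ₙ δ * K)))
    from-weak : WeaklyStable n ε δ 𝒢 → n ^ 3 ≤ 2 * ↧ₙ δ * K * (↧ₙ γ * ↧ₙ α) * S
    from-weak weak =
      ≤-trans (weakly-stable⇒n³≤ K ε>0 ε≤1/K δ>0 ≤-refl (≤-trans (m≤m+n K _) K+↧α≤n) weak A B ∣A∣≡h ∣B∣≡h)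
              (*-monoˡ-≤ S (m≤m*n (2 * ↧ₙ δ * K) (↧ₙ γ * ↧ₙ α)))

open import Defs
open import Data.Nat using (ℕ) renaming (_≤_ to _≤ℕ_)
open import Data.Rational using (ℚ; 0ℚ; _<_; _≤_)
open import Data.Product using (Σ; _×_)
open import Data.Nat using (_+_; _*_)
open import Data.Product using (_,_)
open import Data.Rational using (↧ₙ_; 1ℚ)
open import Data.Rational.Properties using (positive⁻¹)
open Rationals using (1/ℕ; 1/ℕ-pos; ≤1/ℕ⇒*⟦⟧≤)
open Stability using (stable⇒n³≤)

lemmaB1 : Σ ℚ λ δ₀ → (0ℚ < δ₀) × ((δ : ℚ) → 0ℚ < δ → δ ≤ δ₀ →
            Σ ℚ λ c₀ → (0ℚ < c₀) × ((γ ε : ℚ) → 0ℚ < γ → 0ℚ < ε → γ ≤ c₀ → ε ≤ c₀ →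
              Σ ℚ λ α₀ → (0ℚ < α₀) × ((α : ℚ) → 0ℚ < α → α ≤ α₀ →
                Σ ℚ λ μ₀ → (0ℚ < μ₀) × ((μ' : ℚ) → 0ℚ < μ' → μ' ≤ μ₀ →
                  Σ ℕ λ N → (n : ℕ) → N ≤ℕ n → (𝒢 : Collection n) →
                    Stable n γ α ε δ 𝒢 → MuNice n μ' 𝒢))))
lemmaB1 = 1ℚ , positive⁻¹ 1ℚ , λ δ δ>0 _ →
  1/ℕ (K δ) , 1/ℕ-pos (K δ) , λ γ ε γ>0 ε>0 _ ε≤1/K →
  1ℚ , positive⁻¹ 1ℚ , λ α α>0 _ →
  1/ℕ (M δ γ α) , 1/ℕ-pos (M δ γ α) , λ μ′ _ μ′≤1/M →
  K δ + ↧ₙ α , λ n K+↧α≤n 𝒢 stable A B ∣A∣≡⌊n/2⌋ ∣B∣≡⌊n/2⌋ →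
    ≤1/ℕ⇒*⟦⟧≤ (M δ γ α) μ′≤1/M
      (stable⇒n³≤ γ>0 α>0 ε>0 δ>0 ε≤1/K K+↧α≤n stable A B ∣A∣≡⌊n/2⌋ ∣B∣≡⌊n/2⌋)
  where
  K : ℚ → ℕ
  K δ = 128 * ↧ₙ δ
  M : ℚ → ℚ → ℚ → ℕ
  M δ γ α = 2 * ↧ₙ δ * K δ * (↧ₙ γ * ↧ₙ α)
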